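{- Fix a real number $u$. For $k\ge 0$ let $(x)^B_k:=(x-1)(x-3)\cdots(x-2k+1)$, $(x)^B_0:=1$, and let $L:\mathbb{R}[x]\to\mathbb{R}$ be the unique linear functional with $L((x)^B_k)=u^k$ for all $k\ge 0$. For $n\ge 0$ let $B_n^B(u)=\sum_{k=0}^n S^B(n,k)u^k$ be the Bell polynomial of type $B$. Then for each $n\in\mathbb{N}$: (1) $B_n^B(u)=L(x^n)$; (2) $B_{n+1}^B(u)=B_n^B(u)+u\cdot\sum_{j=0}^n 2^{n-j}\binom{n}{j}B_j^B(u)$.
   Context: A set partition of $[n]$ of type $B$ is a set partition of $[\pm n]=\{\pm1,\dots,\pm n\}$ such that whenever $B$ is a block, $-B=\{ -b:b\in B\}$ is also a block, and at most one block satisfies $-B=B$ (the zero block). The non-zero blocks come in pairs $\{B,-B\}$; each pair is counted as one representative non-zero block. $S^B(n,k)$ (Stirling number of type $B$ of the second kind) is the number of set partitions of $[n]$ of type $B$ having exactly $k$ representative non-zero blocks. The polynomials $(x)^B_k$, $k\ge0$, form a basis of $\mathbb{R}[x]$. -}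

module Defs where

open import Level using (Level)
open import Data.Bool using (Bool; true; false; _∧_; _∨_; not; if_then_else_)
open import Data.Nat using (ℕ; zero; suc; ⌊_/2⌋)
import Data.Nat as ℕ
open import Data.Nat.Combinatorics using (_C_)
open import Data.List using (List; []; _∷_; _++_; map; concatMap; length; filter; cartesianProduct; replicate)
open import Data.Bool.ListAction using (all; any)
open import Data.Vec using (Vec; []; _∷_; zipWith; toList)
open import Data.Product using (_×_; _,_; proj₁; proj₂)
open import Relation.Nullary.Decidable using (does)
open import Algebra.Bundles using (CommutativeRing)

-- A subset B of [±n] = {±1,…,±n} is encoded as a pair (P , N) of
-- characteristic vectors: P[i] = true iff +(i+1) ∈ B, N[i] = true iff -(i+1) ∈ B.
Block : ℕ → Set
Block n = Vec Bool n × Vec Bool n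

negB : ∀ {n} → Block n → Block n
negB (P , N) = (N , P)

allVecs : (n : ℕ) → List (Vec Bool n)
allVecs zero = [] ∷ []
allVecs (suc n) = concatMap (λ v → (true ∷ v) ∷ (false ∷ v) ∷ []) (allVecs n)

allBlocks : (n : ℕ) → List (Block n)
allBlocks n = cartesianProduct (allVecs n) (allVecs n)

sublists : ∀ {a} {A : Set a} → List A → List (List A)
sublists [] = [] ∷ []
sublists (x ∷ xs) = map (x ∷_) (sublists xs) ++ sublists xs

orV : ∀ {n} → Vec Bool n → Bool
orV v = any (λ b → b) (toList v)

andV : ∀ {n} → Vec Bool n → Bool
andV v = all (λ b → b) (toList v)

eqBool : Bool → Bool → Bool
eqBool true b = b
eqBool false b = not b

eqVec : ∀ {n} → Vec Bool n → Vec Bool n → Bool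
eqVec u v = andV (zipWith eqBool u v)

eqBlock : ∀ {n} → Block n → Block n → Bool
eqBlock (P , N) (P' , N') = eqVec P P' ∧ eqVec N N'

nonemptyB : ∀ {n} → Block n → Bool
nonemptyB (P , N) = orV P ∨ orV N

disjointB : ∀ {n} → Block n → Block n → Bool
disjointB (P , N) (P' , N') = not (orV (zipWith _∧_ P P') ∨ orV (zipWith _∧_ N N'))

pairwiseDisjoint : ∀ {n} → List (Block n) → Bool
pairwiseDisjoint [] = true
pairwiseDisjoint (b ∷ bs) = all (disjointB b) bs ∧ pairwiseDisjoint bs

unionP : ∀ {n} → List (Block n) → Vec Bool n
unionP {n} [] = Data.Vec.replicate n false
unionP (b ∷ bs) = zipWith _∨_ (proj₁ b) (unionP bs)

unionN : ∀ {n} → List (Block n) → Vec Bool n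
unionN {n} [] = Data.Vec.replicate n false
unionN (b ∷ bs) = zipWith _∨_ (proj₂ b) (unionN bs)

memB : ∀ {n} → Block n → List (Block n) → Bool
memB b F = any (eqBlock b) F

isZeroBlock : ∀ {n} → Block n → Bool
isZeroBlock b = eqBlock (negB b) b

isTypeBPartition : ∀ {n} → List (Block n) → Bool
isTypeBPartition F =
  all nonemptyB F ∧ pairwiseDisjoint F ∧ andV (unionP F) ∧ andV (unionN F)
  ∧ all (λ b → memB (negB b) F) F
  ∧ atMostOne (length (filter (λ b → (Data.Bool._≟_ (isZeroBlock b) true)) F))
  where
  atMostOne : ℕ → Bool
  atMostOne zero = true
  atMostOne (suc zero) = true
  atMostOne (suc (suc _)) = false

-- number of representative non-zero blocks: non-zero blocks come in pairs {B,-B}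
repNonZeroBlocks : ∀ {n} → List (Block n) → ℕ
repNonZeroBlocks F = ⌊ length (filter (λ b → (Data.Bool._≟_ (isZeroBlock b) false)) F) /2⌋

eqℕ : ℕ → ℕ → Bool
eqℕ m k = does (Data.Nat._≟_ m k)

typeBPartitions : (n : ℕ) → List (List (Block n))
typeBPartitions n = filter (λ F → (Data.Bool._≟_ (isTypeBPartition F) true)) (sublists (allBlocks n))

SB : ℕ → ℕ → ℕ
SB n k = length (filter (λ F → (Data.Nat._≟_ (repNonZeroBlocks F) k)) (typeBPartitions n))

module WithRing {c ℓ} (R : CommutativeRing c ℓ) where
  open CommutativeRing R

  ι : ℕ → Carrier
  ι zero = 0#
  ι (suc n) = 1# + ι n

  pow : Carrier → ℕ → Carrier
  pow a zero = 1#
  pow a (suc k) = a * pow a k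

  sumTo : ℕ → (ℕ → Carrier) → Carrier
  sumTo zero f = f 0
  sumTo (suc n) f = sumTo n f + f (suc n)

  -- polynomials in R[x] as coefficient lists, lowest degree first
  Poly : Set c
  Poly = List Carrier

  addP : Poly → Poly → Poly
  addP [] q = q
  addP (a ∷ p) [] = a ∷ p
  addP (a ∷ p) (b ∷ q) = (a + b) ∷ addP p q

  scaleP : Carrier → Poly → Poly
  scaleP a p = map (a *_) p

  mulXminus : Carrier → Poly → Poly
  mulXminus a p = addP (0# ∷ p) (scaleP (- a) p)

  fallB : ℕ → Poly
  fallB zero = 1# ∷ []
  fallB (suc k) = mulXminus (ι (2 ℕ.* k ℕ.+ 1)) (fallB k)

  monomial : ℕ → Poly
  monomial n = replicate n 0# ++ (1# ∷ [])

  -- the linear functional L : R[x] → R determined by its values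
  -- m k = L(x^k) on the monomial basis:  L(Σ a_j x^j) = Σ a_j m_j
  applyFrom : (ℕ → Carrier) → ℕ → Poly → Carrier
  applyFrom m i [] = 0#
  applyFrom m i (a ∷ p) = a * m i + applyFrom m (suc i) p

  applyL : (ℕ → Carrier) → Poly → Carrier
  applyL m p = applyFrom m 0 p

  BellB : ℕ → Carrier → Carrier
  BellB n u = sumTo n (λ k → ι (SB n k) * pow u k)

{-# OPTIONS --safe #-}
module Submission where

open import Defs
open import Data.Nat using (ℕ; suc; _∸_)
open import Data.Nat.Combinatorics using (_C_)
open import Data.Product using (_×_)
open import Algebra.Bundles using (CommutativeRing)

open import Algebra.Bundles using (CommutativeSemiring)
import Algebra.Properties.CommutativeSemigroup as CommutativeSemigroupProperties
open import Data.Bool using (Bool; true; false; _∧_; _∨_; not; if_then_else_)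
import Data.Bool as Bool
open import Data.Bool.Properties using (∨-zeroʳ; ∧-identityʳ; ∧-zeroʳ; ∧-comm; not-involutive)
open import Data.Bool.ListAction using (any; all)
open import Data.Empty using (⊥; ⊥-elim)
open import Data.Fin using (Fin; zero; suc)
open import Data.List using (List; []; _∷_; _++_; map; length; filter; concatMap; replicate)
import Data.List.Properties as Listₚ
open import Data.List.Membership.Propositional using (_∈_; _∉_; find; lose)
open import Data.List.Membership.Propositional.Properties
  using (∈-filter⁺; ∈-filter⁻; ∈-++⁺ˡ; ∈-++⁺ʳ; ∈-++⁻; ∈-map⁺; ∈-map⁻; ∈-cartesianProduct⁺; ∈-concatMap⁺; ∈-concatMap⁻)
open import Data.List.Membership.Propositional.Properties.WithK using (unique∧set⇒bag)
open import Data.List.Relation.Binary.BagAndSetEquality using (∼bag⇒↭)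
open import Data.List.Relation.Binary.Permutation.Propositional using (_↭_; ↭-trans; ↭-reflexive)
import Data.List.Relation.Binary.Permutation.Propositional.Properties as Perm
open Perm using (↭-length; filter-↭)
open import Data.List.Relation.Unary.All as All using (All; []; _∷_)
open import Data.List.Relation.Unary.AllPairs using ([]; _∷_)
open import Data.List.Relation.Unary.Any using (here; there)
open import Data.List.Relation.Unary.Unique.Propositional using (Unique)
import Data.List.Relation.Unary.Unique.Propositional.Properties as Unique
open import Data.Nat as Nat using (zero; _≤_; _<_; z≤n; s≤s; ⌊_/2⌋)
open import Data.Nat.Combinatorics using (k>n⇒nCk≡0; nCk+nC[k+1]≡[n+1]C[k+1])
open import Data.Nat.ListAction using (sum)
import Data.Nat.Properties as ℕₚ
open import Data.Nat.Tactic.RingSolver using (solve-∀)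
open import Data.Product using (∃; ∃₂; _,_; proj₁; proj₂)
open import Data.Sum using (_⊎_; inj₁; inj₂)
import Data.Sum as Sum
open import Data.Vec using (Vec; []; _∷_; lookup; zipWith)
import Data.Vec as Vec
import Data.Vec.Properties as Vecₚ
open import Function using (_∘_)
open import Function.Bundles using (mk⇔)
open import Relation.Binary.PropositionalEquality as ≡ using (_≡_; _≢_; cong; cong₂)
open import Relation.Nullary using (does)

-- A type B partition of [n+1] arises from exactly one of [n] by placing the new pair ±a in one of
-- 2k + 2 ways, k being the number of representative non-zero blocks: into the zero block (creating
-- it if there is none), into one of the 2k non-zero blocks B (with -a going into -B), or as a new
-- pair of blocks {a}, {-a}. Hence S^B(n+1,k) = (2k+1) S^B(n,k) + S^B(n,k-1). As
-- x (x)^B_k = (x)^B_{k+1} + (2k+1) (x)^B_k, the same recurrence gives x^n = Σ_k S^B(n,k) (x)^B_k,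
-- and applying L proves (1). By induction on n and Pascal's rule the recurrence also yields
-- S^B(n+1,k+1) = S^B(n,k+1) + Σ_j 2^(n-j) C(n,j) S^B(j,k), which summed against u^(k+1) is (2).

module Sums {c ℓ} (S : CommutativeSemiring c ℓ) where
  open CommutativeSemiring S
  open CommutativeSemigroupProperties +-commutativeSemigroup using (interchange)

  Σ≤ : ℕ → (ℕ → Carrier) → Carrier
  Σ≤ zero    f = f 0
  Σ≤ (suc n) f = Σ≤ n f + f (suc n)

  Σ≤-cong : ∀ n {f g : ℕ → Carrier} → (∀ j → j ≤ n → f j ≈ g j) → Σ≤ n f ≈ Σ≤ n g
  Σ≤-cong zero    f≈g = f≈g 0 z≤n
  Σ≤-cong (suc n) f≈g =
    +-cong (Σ≤-cong n (λ j j≤n → f≈g j (ℕₚ.m≤n⇒m≤1+n j≤n))) (f≈g (suc n) ℕₚ.≤-refl)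

  Σ≤-+ : ∀ n (f g : ℕ → Carrier) → Σ≤ n (λ j → f j + g j) ≈ Σ≤ n f + Σ≤ n g
  Σ≤-+ zero    f g = refl
  Σ≤-+ (suc n) f g = trans (+-congʳ (Σ≤-+ n f g)) (interchange _ _ _ _)

  Σ≤-*ˡ : ∀ n a (f : ℕ → Carrier) → Σ≤ n (λ j → a * f j) ≈ a * Σ≤ n f
  Σ≤-*ˡ zero    a f = refl
  Σ≤-*ˡ (suc n) a f = trans (+-congʳ (Σ≤-*ˡ n a f)) (sym (distribˡ a _ _))

  Σ≤-*ʳ : ∀ n a (f : ℕ → Carrier) → Σ≤ n (λ j → f j * a) ≈ Σ≤ n f * a
  Σ≤-*ʳ zero    a f = refl
  Σ≤-*ʳ (suc n) a f = trans (+-congʳ (Σ≤-*ʳ n a f)) (sym (distribʳ a _ _))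

  Σ≤-zero : ∀ n → Σ≤ n (λ _ → 0#) ≈ 0#
  Σ≤-zero zero    = refl
  Σ≤-zero (suc n) = trans (+-identityʳ _) (Σ≤-zero n)

  Σ≤-head : ∀ n (f : ℕ → Carrier) → Σ≤ (suc n) f ≈ f 0 + Σ≤ n (λ j → f (suc j))
  Σ≤-head zero    f = refl
  Σ≤-head (suc n) f = trans (+-congʳ (Σ≤-head n f)) (+-assoc _ _ _)

  Σ≤-comm : ∀ n p (g : ℕ → ℕ → Carrier) →
            Σ≤ n (λ i → Σ≤ p (g i)) ≈ Σ≤ p (λ j → Σ≤ n (λ i → g i j))
  Σ≤-comm zero    p g = refl
  Σ≤-comm (suc n) p g = trans (+-congʳ (Σ≤-comm n p g)) (sym (Σ≤-+ p _ _))

  Σ≤-pad : ∀ n d (f : ℕ → Carrier) → (∀ j → n < j → f j ≈ 0#) → Σ≤ (d Nat.+ n) f ≈ Σ≤ n f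
  Σ≤-pad n zero    f f≈0 = refl
  Σ≤-pad n (suc d) f f≈0 =
    trans (+-cong (Σ≤-pad n d f f≈0) (f≈0 (suc (d Nat.+ n)) (s≤s (ℕₚ.m≤n+m n d)))) (+-identityʳ _)

  Σ≤-pad-≤ : ∀ {m n} (f : ℕ → Carrier) → m ≤ n → (∀ j → m < j → f j ≈ 0#) → Σ≤ n f ≈ Σ≤ m f
  Σ≤-pad-≤ {m} {n} f m≤n f≈0 =
    trans (reflexive (cong (λ k → Σ≤ k f) (≡.sym (ℕₚ.m∸n+n≡m m≤n)))) (Σ≤-pad m (n ∸ m) f f≈0)

module ℕΣ = Sums ℕₚ.+-*-commutativeSemiring

-- f (k - 1), with the convention f (-1) = 0.
atPred : (ℕ → ℕ) → ℕ → ℕ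
atPred f zero    = 0
atPred f (suc k) = f k

record TypeBStirlingRecurrence (S : ℕ → ℕ → ℕ) : Set where
  open Nat using (_+_; _*_)
  field
    S-0-0   : S 0 0 ≡ 1
    S-0-suc : ∀ k → S 0 (suc k) ≡ 0
    S-suc   : ∀ n k → S (suc n) k ≡ (2 * k + 1) * S n k + atPred (S n) k

module TypeBStirling {S : ℕ → ℕ → ℕ} (rec : TypeBStirlingRecurrence S) where
  open Nat using (_+_; _*_; _^_)
  open TypeBStirlingRecurrence rec
  open ℕΣ using (Σ≤; Σ≤-cong; Σ≤-+; Σ≤-*ˡ; Σ≤-zero; Σ≤-head)
  open ≡.≡-Reasoning

  S-vanish : ∀ n k → n < k → S n k ≡ 0
  S-vanish zero    (suc k) _         = S-0-suc k
  S-vanish (suc n) (suc k) (s≤s n<k) = begin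
    S (suc n) (suc k)                         ≡⟨ S-suc n (suc k) ⟩
    (2 * suc k + 1) * S n (suc k) + S n k     ≡⟨ cong₂ (λ a b → (2 * suc k + 1) * a + b)
                                                   (S-vanish n (suc k) (ℕₚ.m<n⇒m<1+n n<k)) (S-vanish n k n<k) ⟩
    (2 * suc k + 1) * 0 + 0                   ≡⟨ ℕₚ.+-identityʳ _ ⟩
    (2 * suc k + 1) * 0                       ≡⟨ ℕₚ.*-zeroʳ (2 * suc k + 1) ⟩
    0                                         ∎

  S-suc-zero : ∀ n → S (suc n) 0 ≡ S n 0
  S-suc-zero n = ≡.trans (S-suc n 0) (≡.trans (ℕₚ.+-identityʳ _) (ℕₚ.*-identityˡ _))

  weight : ℕ → ℕ → ℕ
  weight n j = 2 ^ (n ∸ j) * (n C j)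

  weighted : ℕ → ℕ → ℕ
  weighted n k = Σ≤ n (λ j → weight n j * S j k)

  private
    Σ≤-weight-atPred : ∀ n k → Σ≤ n (λ j → weight n j * atPred (S j) k) ≡ atPred (weighted n) k
    Σ≤-weight-atPred n zero    = ≡.trans (Σ≤-cong n (λ j _ → ℕₚ.*-zeroʳ (weight n j))) (Σ≤-zero n)
    Σ≤-weight-atPred n (suc k) = ≡.refl

    pascal-weight : ∀ n j s → 2 ^ (n ∸ j) * (suc n C suc j) * s ≡ weight n j * s + 2 ^ (n ∸ j) * (n C suc j) * s
    pascal-weight n j s = ≡.trans (cong (λ c → 2 ^ (n ∸ j) * c * s) (≡.sym (nCk+nC[k+1]≡[n+1]C[k+1] n j)))
                                  (distrib (2 ^ (n ∸ j)) (n C j) (n C suc j) s)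
      where distrib : ∀ a b c s → a * (b + c) * s ≡ a * b * s + a * c * s
            distrib = solve-∀

  weighted-suc : ∀ n k → weighted (suc n) k ≡ (2 * k + 3) * weighted n k + atPred (weighted n) k
  weighted-suc n k = begin
    weighted (suc n) k
      ≡⟨ Σ≤-head n (λ j → weight (suc n) j * S j k) ⟩
    weight (suc n) 0 * S 0 k + Σ≤ n (λ j → 2 ^ (n ∸ j) * (suc n C suc j) * S (suc j) k)
      ≡⟨ cong (weight (suc n) 0 * S 0 k +_) (≡.trans (Σ≤-cong n (λ j _ → pascal-weight n j (S (suc j) k))) (Σ≤-+ n _ _)) ⟩
    weight (suc n) 0 * S 0 k + (Σ≤ n (λ j → weight n j * S (suc j) k) + Σ≤ n (λ j → 2 ^ (n ∸ j) * (n C suc j) * S (suc j) k))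
      ≡⟨ swap-front (weight (suc n) 0 * S 0 k) (Σ≤ n (λ j → weight n j * S (suc j) k)) _ ⟩
    Σ≤ n (λ j → weight n j * S (suc j) k) + (weight (suc n) 0 * S 0 k + Σ≤ n (λ j → 2 ^ (n ∸ j) * (n C suc j) * S (suc j) k))
      ≡⟨ cong₂ _+_ new-row (≡.sym (Σ≤-head n doubled)) ⟩
    ((2 * k + 1) * weighted n k + atPred (weighted n) k) + Σ≤ (suc n) doubled
      ≡⟨ cong (((2 * k + 1) * weighted n k + atPred (weighted n) k) +_) doubled-sum ⟩
    ((2 * k + 1) * weighted n k + atPred (weighted n) k) + 2 * weighted n k
      ≡⟨ collect (2 * k) (weighted n k) (atPred (weighted n) k) ⟩
    (2 * k + 3) * weighted n k + atPred (weighted n) k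
      ∎
    where
    swap-front : ∀ a b c → a + (b + c) ≡ b + (a + c)
    swap-front = solve-∀
    collect : ∀ a t p → (a + 1) * t + p + 2 * t ≡ (a + 3) * t + p
    collect = solve-∀
    doubled : ℕ → ℕ
    doubled j = 2 ^ (suc n ∸ j) * (n C j) * S j k
    new-row : Σ≤ n (λ j → weight n j * S (suc j) k) ≡ (2 * k + 1) * weighted n k + atPred (weighted n) k
    new-row = begin
      Σ≤ n (λ j → weight n j * S (suc j) k)
        ≡⟨ Σ≤-cong n (λ j _ → ≡.trans (cong (weight n j *_) (S-suc j k)) (expand (weight n j) (2 * k + 1) (S j k) (atPred (S j) k))) ⟩
      Σ≤ n (λ j → (2 * k + 1) * (weight n j * S j k) + weight n j * atPred (S j) k)
        ≡⟨ Σ≤-+ n _ _ ⟩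
      Σ≤ n (λ j → (2 * k + 1) * (weight n j * S j k)) + Σ≤ n (λ j → weight n j * atPred (S j) k)
        ≡⟨ cong₂ _+_ (Σ≤-*ˡ n (2 * k + 1) _) (Σ≤-weight-atPred n k) ⟩
      (2 * k + 1) * weighted n k + atPred (weighted n) k
        ∎
      where expand : ∀ a c s p → a * (c * s + p) ≡ c * (a * s) + a * p
            expand = solve-∀
    doubled-sum : Σ≤ (suc n) doubled ≡ 2 * weighted n k
    doubled-sum = begin
      Σ≤ n doubled + 2 ^ (suc n ∸ suc n) * (n C suc n) * S (suc n) k
        ≡⟨ cong (λ c → Σ≤ n doubled + 2 ^ (suc n ∸ suc n) * c * S (suc n) k) (k>n⇒nCk≡0 (ℕₚ.n<1+n n)) ⟩
      Σ≤ n doubled + 2 ^ (n ∸ n) * 0 * S (suc n) k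
        ≡⟨ cong (λ z → Σ≤ n doubled + z * S (suc n) k) (ℕₚ.*-zeroʳ (2 ^ (n ∸ n))) ⟩
      Σ≤ n doubled + 0
        ≡⟨ ℕₚ.+-identityʳ (Σ≤ n doubled) ⟩
      Σ≤ n doubled
        ≡⟨ Σ≤-cong n (λ j j≤n → ≡.trans (cong (λ e → 2 ^ e * (n C j) * S j k) (ℕₚ.+-∸-assoc 1 j≤n))
                                         (reassoc (2 ^ (n ∸ j)) (n C j) (S j k))) ⟩
      Σ≤ n (λ j → 2 * (weight n j * S j k))
        ≡⟨ Σ≤-*ˡ n 2 _ ⟩
      2 * weighted n k
        ∎
      where reassoc : ∀ a b c → 2 * a * b * c ≡ 2 * (a * b * c)
            reassoc = solve-∀

  S-suc-via-weighted : ∀ n k → S (suc n) k ≡ S n k + atPred (weighted n) k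
  S-suc-via-weighted n       zero    = ≡.trans (S-suc-zero n) (≡.sym (ℕₚ.+-identityʳ (S n 0)))
  S-suc-via-weighted zero    (suc k) = begin
    S 1 (suc k)                               ≡⟨ S-suc 0 (suc k) ⟩
    (2 * suc k + 1) * S 0 (suc k) + S 0 k     ≡⟨ cong (λ s → (2 * suc k + 1) * s + S 0 k) (S-0-suc k) ⟩
    (2 * suc k + 1) * 0 + S 0 k               ≡⟨ cong (_+ S 0 k) (ℕₚ.*-zeroʳ (2 * suc k + 1)) ⟩
    S 0 k                                     ≡⟨ cong₂ _+_ (≡.sym (S-0-suc k)) (≡.sym (ℕₚ.*-identityˡ (S 0 k))) ⟩
    S 0 (suc k) + weighted 0 k                ∎
  S-suc-via-weighted (suc n) (suc k) = begin
    S (suc (suc n)) (suc k)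
      ≡⟨ S-suc (suc n) (suc k) ⟩
    c * S (suc n) (suc k) + S (suc n) k
      ≡⟨ cong₂ (λ a b → c * a + b) (S-suc-via-weighted n (suc k)) (S-suc-via-weighted n k) ⟩
    c * (S n (suc k) + weighted n k) + (S n k + atPred (weighted n) k)
      ≡⟨ regroup c (S n (suc k)) (weighted n k) (S n k) (atPred (weighted n) k) ⟩
    (c * S n (suc k) + S n k) + (c * weighted n k + atPred (weighted n) k)
      ≡⟨ cong₂ _+_ (≡.sym (S-suc n (suc k))) (≡.trans (cong (λ a → a * weighted n k + atPred (weighted n) k) (twice-suc k)) (≡.sym (weighted-suc n k))) ⟩
    S (suc n) (suc k) + weighted (suc n) k
      ∎
    where
    c = 2 * suc k + 1
    regroup : ∀ c s t s′ p → c * (s + t) + (s′ + p) ≡ (c * s + s′) + (c * t + p)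
    regroup = solve-∀
    twice-suc : ∀ k → 2 * suc k + 1 ≡ 2 * k + 3
    twice-suc = solve-∀

module Moments {c ℓ} (R : CommutativeRing c ℓ) where
  open CommutativeRing R
  open WithRing R
  open Sums commutativeSemiring
  open import Relation.Binary.Reasoning.Setoid setoid

  sumTo≡Σ≤ : ∀ n f → sumTo n f ≡ Σ≤ n f
  sumTo≡Σ≤ zero    f = ≡.refl
  sumTo≡Σ≤ (suc n) f = cong (_+ f (suc n)) (sumTo≡Σ≤ n f)

  ι-+ : ∀ a b → ι (a Nat.+ b) ≈ ι a + ι b
  ι-+ zero    b = sym (+-identityˡ (ι b))
  ι-+ (suc a) b = trans (+-congˡ (ι-+ a b)) (sym (+-assoc 1# (ι a) (ι b)))

  ι-* : ∀ a b → ι (a Nat.* b) ≈ ι a * ι b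
  ι-* zero    b = sym (zeroˡ (ι b))
  ι-* (suc a) b = begin
    ι (b Nat.+ a Nat.* b)    ≈⟨ ι-+ b (a Nat.* b) ⟩
    ι b + ι (a Nat.* b)      ≈⟨ +-cong (sym (*-identityˡ (ι b))) (ι-* a b) ⟩
    1# * ι b + ι a * ι b     ≈⟨ sym (distribʳ (ι b) 1# (ι a)) ⟩
    (1# + ι a) * ι b         ∎

  ι-Σ≤ : ∀ n (f : ℕ → ℕ) → ι (ℕΣ.Σ≤ n f) ≈ Σ≤ n (λ j → ι (f j))
  ι-Σ≤ zero    f = refl
  ι-Σ≤ (suc n) f = trans (ι-+ (ℕΣ.Σ≤ n f) (f (suc n))) (+-congʳ (ι-Σ≤ n f))

  Σ≤-ι-atPred : ∀ (h : ℕ → ℕ) n (g : ℕ → Carrier) →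
                Σ≤ (suc n) (λ k → ι (atPred h k) * g k) ≈ Σ≤ n (λ k → ι (h k) * g (suc k))
  Σ≤-ι-atPred h n g = trans (Σ≤-head n _) (trans (+-congʳ (zeroˡ (g 0))) (+-identityˡ _))

  applyFrom-shift : ∀ (m : ℕ → Carrier) i p → applyFrom m (suc i) p ≡ applyFrom (λ j → m (suc j)) i p
  applyFrom-shift m i []      = ≡.refl
  applyFrom-shift m i (a ∷ p) = cong (a * m (suc i) +_) (applyFrom-shift m (suc i) p)

  applyFrom-addP : ∀ (m : ℕ → Carrier) i p q → applyFrom m i (addP p q) ≈ applyFrom m i p + applyFrom m i q
  applyFrom-addP m i []      q       = sym (+-identityˡ _)
  applyFrom-addP m i (a ∷ p) []      = sym (+-identityʳ _)
  applyFrom-addP m i (a ∷ p) (b ∷ q) = begin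
    (a + b) * m i + applyFrom m (suc i) (addP p q)
      ≈⟨ +-cong (distribʳ (m i) a b) (applyFrom-addP m (suc i) p q) ⟩
    (a * m i + b * m i) + (applyFrom m (suc i) p + applyFrom m (suc i) q)
      ≈⟨ interchange _ _ _ _ ⟩
    (a * m i + applyFrom m (suc i) p) + (b * m i + applyFrom m (suc i) q)
      ∎
    where open CommutativeSemigroupProperties +-commutativeSemigroup using (interchange)

  applyFrom-scaleP : ∀ (m : ℕ → Carrier) i a p → applyFrom m i (scaleP a p) ≈ a * applyFrom m i p
  applyFrom-scaleP m i a []      = sym (zeroʳ a)
  applyFrom-scaleP m i a (b ∷ p) = begin
    (a * b) * m i + applyFrom m (suc i) (scaleP a p)
      ≈⟨ +-cong (*-assoc a b (m i)) (applyFrom-scaleP m (suc i) a p) ⟩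
    a * (b * m i) + a * applyFrom m (suc i) p
      ≈⟨ sym (distribˡ a _ _) ⟩
    a * (b * m i + applyFrom m (suc i) p)
      ∎

  applyL-mulX : ∀ (m : ℕ → Carrier) p → applyL m (0# ∷ p) ≈ applyL (λ j → m (suc j)) p
  applyL-mulX m p = trans (+-cong (zeroˡ (m 0)) (reflexive (applyFrom-shift m 0 p))) (+-identityˡ _)

  -- x (x)^B_k = (x)^B_{k+1} + (2k+1) (x)^B_k, read through the functional.
  applyL-fallB-suc : ∀ (m : ℕ → Carrier) k →
    applyL (λ j → m (suc j)) (fallB k) ≈ ι (2 Nat.* k Nat.+ 1) * applyL m (fallB k) + applyL m (fallB (suc k))
  applyL-fallB-suc m k = begin
    X
      ≈⟨ sym (+-identityˡ X) ⟩
    0# + X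
      ≈⟨ +-congʳ (sym (trans (sym (distribʳ F a (- a))) (trans (*-congʳ (-‿inverseʳ a)) (zeroˡ F)))) ⟩
    (a * F + - a * F) + X
      ≈⟨ +-assoc _ _ _ ⟩
    a * F + (- a * F + X)
      ≈⟨ +-congˡ (trans (+-comm _ _) (sym (trans (applyFrom-addP m 0 (0# ∷ fallB k) (scaleP (- a) (fallB k)))
                                              (+-cong (applyL-mulX m (fallB k)) (applyFrom-scaleP m 0 (- a) (fallB k)))))) ⟩
    a * F + applyL m (fallB (suc k))
      ∎
    where
    a = ι (2 Nat.* k Nat.+ 1)
    F = applyL m (fallB k)
    X = applyL (λ j → m (suc j)) (fallB k)

  module Bell {S : ℕ → ℕ → ℕ} (rec : TypeBStirlingRecurrence S) where
    open TypeBStirlingRecurrence rec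
    open TypeBStirling rec

    Bell : ℕ → Carrier → Carrier
    Bell n u = Σ≤ n (λ k → ι (S n k) * pow u k)

    Σ≤-S-pad : ∀ {j n} (g : ℕ → Carrier) → j ≤ n → Σ≤ n (λ k → ι (S j k) * g k) ≈ Σ≤ j (λ k → ι (S j k) * g k)
    Σ≤-S-pad {j} g j≤n = Σ≤-pad-≤ _ j≤n (λ k j<k → trans (*-congʳ (reflexive (cong ι (S-vanish j k j<k)))) (zeroˡ (g k)))

    ι-S-suc : ∀ n k x → ι (S (suc n) k) * x ≈ ι (S n k) * (ι (2 Nat.* k Nat.+ 1) * x) + ι (atPred (S n) k) * x
    ι-S-suc n k x = begin
      ι (S (suc n) k) * x
        ≈⟨ *-congʳ (trans (reflexive (cong ι (S-suc n k))) (ι-+ ((2 Nat.* k Nat.+ 1) Nat.* S n k) (atPred (S n) k))) ⟩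
      (ι ((2 Nat.* k Nat.+ 1) Nat.* S n k) + ι (atPred (S n) k)) * x
        ≈⟨ distribʳ x _ _ ⟩
      ι ((2 Nat.* k Nat.+ 1) Nat.* S n k) * x + ι (atPred (S n) k) * x
        ≈⟨ +-congʳ (trans (*-congʳ (trans (ι-* (2 Nat.* k Nat.+ 1) (S n k)) (*-comm _ _))) (*-assoc _ _ _)) ⟩
      ι (S n k) * (ι (2 Nat.* k Nat.+ 1) * x) + ι (atPred (S n) k) * x
        ∎

    -- x^n = Σ_k S(n,k) (x)^B_k, tested against every sequence of moments m (so that the
    -- inductive step can use the shifted moments).
    applyL-monomial : ∀ n (m : ℕ → Carrier) → applyL m (monomial n) ≈ Σ≤ n (λ k → ι (S n k) * applyL m (fallB k))
    applyL-monomial zero    m = begin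
      1# * m 0 + 0#                 ≈⟨ +-identityʳ _ ⟩
      1# * m 0                      ≈⟨ *-congˡ (sym (trans (+-identityʳ _) (*-identityˡ (m 0)))) ⟩
      1# * (1# * m 0 + 0#)          ≈⟨ *-congʳ (sym (trans (reflexive (cong ι S-0-0)) (+-identityʳ 1#))) ⟩
      ι (S 0 0) * applyL m (fallB 0) ∎
    applyL-monomial (suc n) m = begin
      applyL m (0# ∷ monomial n)
        ≈⟨ applyL-mulX m (monomial n) ⟩
      applyL m′ (monomial n)
        ≈⟨ applyL-monomial n m′ ⟩
      Σ≤ n (λ k → ι (S n k) * applyL m′ (fallB k))
        ≈⟨ Σ≤-cong n (λ k _ → trans (*-congˡ (applyL-fallB-suc m k)) (distribˡ _ _ _)) ⟩
      Σ≤ n (λ k → ι (S n k) * g k + ι (S n k) * f (suc k))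
        ≈⟨ Σ≤-+ n _ _ ⟩
      Σ≤ n (λ k → ι (S n k) * g k) + Σ≤ n (λ k → ι (S n k) * f (suc k))
        ≈⟨ +-cong (sym (Σ≤-S-pad g (ℕₚ.n≤1+n n))) (sym (Σ≤-ι-atPred (S n) n f)) ⟩
      Σ≤ (suc n) (λ k → ι (S n k) * g k) + Σ≤ (suc n) (λ k → ι (atPred (S n) k) * f k)
        ≈⟨ sym (Σ≤-+ (suc n) _ _) ⟩
      Σ≤ (suc n) (λ k → ι (S n k) * g k + ι (atPred (S n) k) * f k)
        ≈⟨ Σ≤-cong (suc n) (λ k _ → sym (ι-S-suc n k (f k))) ⟩
      Σ≤ (suc n) (λ k → ι (S (suc n) k) * f k)
        ∎
      where
      m′ : ℕ → Carrier
      m′ j = m (suc j)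
      f : ℕ → Carrier
      f k = applyL m (fallB k)
      g : ℕ → Carrier
      g k = ι (2 Nat.* k Nat.+ 1) * f k

    Σ≤-weighted-pow : ∀ n u → Σ≤ n (λ k → ι (weighted n k) * pow u k) ≈ Σ≤ n (λ j → ι (weight n j) * Bell j u)
    Σ≤-weighted-pow n u = begin
      Σ≤ n (λ k → ι (weighted n k) * pow u k)
        ≈⟨ Σ≤-cong n (λ k _ → trans (*-congʳ (ι-Σ≤ n _)) (sym (Σ≤-*ʳ n (pow u k) _))) ⟩
      Σ≤ n (λ k → Σ≤ n (λ j → ι (weight n j Nat.* S j k) * pow u k))
        ≈⟨ Σ≤-comm n n _ ⟩
      Σ≤ n (λ j → Σ≤ n (λ k → ι (weight n j Nat.* S j k) * pow u k))
        ≈⟨ Σ≤-cong n (λ j _ → trans (Σ≤-cong n (λ k _ → trans (*-congʳ (ι-* (weight n j) (S j k))) (*-assoc _ _ _))) (Σ≤-*ˡ n _ _)) ⟩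
      Σ≤ n (λ j → ι (weight n j) * Σ≤ n (λ k → ι (S j k) * pow u k))
        ≈⟨ Σ≤-cong n (λ j j≤n → *-congˡ (Σ≤-S-pad (pow u) j≤n)) ⟩
      Σ≤ n (λ j → ι (weight n j) * Bell j u)
        ∎

    Bell-suc : ∀ n u → Bell (suc n) u ≈ Bell n u + u * Σ≤ n (λ j → ι (weight n j) * Bell j u)
    Bell-suc n u = begin
      Σ≤ (suc n) (λ k → ι (S (suc n) k) * pow u k)
        ≈⟨ Σ≤-cong (suc n) (λ k _ → trans (*-congʳ (trans (reflexive (cong ι (S-suc-via-weighted n k)))
                                                          (ι-+ (S n k) (atPred (weighted n) k))))
                                           (distribʳ _ _ _)) ⟩
      Σ≤ (suc n) (λ k → ι (S n k) * pow u k + ι (atPred (weighted n) k) * pow u k)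
        ≈⟨ Σ≤-+ (suc n) _ _ ⟩
      Σ≤ (suc n) (λ k → ι (S n k) * pow u k) + Σ≤ (suc n) (λ k → ι (atPred (weighted n) k) * pow u k)
        ≈⟨ +-cong (Σ≤-S-pad (pow u) (ℕₚ.n≤1+n n)) (Σ≤-ι-atPred (weighted n) n (pow u)) ⟩
      Bell n u + Σ≤ n (λ k → ι (weighted n k) * (u * pow u k))
        ≈⟨ +-congˡ (trans (Σ≤-cong n (λ k _ → x∙yz≈y∙xz _ u _)) (Σ≤-*ˡ n u _)) ⟩
      Bell n u + u * Σ≤ n (λ k → ι (weighted n k) * pow u k)
        ≈⟨ +-congˡ (*-congˡ (Σ≤-weighted-pow n u)) ⟩
      Bell n u + u * Σ≤ n (λ j → ι (weight n j) * Bell j u)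
        ∎
      where open CommutativeSemigroupProperties *-commutativeSemigroup using (x∙yz≈y∙xz)

module TypeBPartitions where
  open ≡
  open Nat using (_+_; _*_)

  ∧-true⁻ : ∀ {x y} → x ∧ y ≡ true → x ≡ true × y ≡ true
  ∧-true⁻ {true} {true} _ = refl , refl

  ∧-true⁺ : ∀ {x y} → x ≡ true → y ≡ true → x ∧ y ≡ true
  ∧-true⁺ refl y≡true = y≡true

  ∨-true⁻ : ∀ {x y} → x ∨ y ≡ true → x ≡ true ⊎ y ≡ true
  ∨-true⁻ {true}  _ = inj₁ refl
  ∨-true⁻ {false} y≡true = inj₂ y≡true

  ∨-true⁺ˡ : ∀ {x y} → x ≡ true → x ∨ y ≡ true
  ∨-true⁺ˡ refl = refl

  ∨-true⁺ʳ : ∀ {x y} → y ≡ true → x ∨ y ≡ true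
  ∨-true⁺ʳ {true}  _ = refl
  ∨-true⁺ʳ {false} y≡true = y≡true

  not-true⁻ : ∀ {x} → not x ≡ true → x ≡ false
  not-true⁻ {false} _ = refl

  true⊎false : ∀ x → x ≡ true ⊎ x ≡ false
  true⊎false true  = inj₁ refl
  true⊎false false = inj₂ refl

  true≢false : true ≢ false
  true≢false ()

  ≡-from-true⇔true : ∀ {x y} → (x ≡ true → y ≡ true) → (y ≡ true → x ≡ true) → x ≡ y
  ≡-from-true⇔true {true}  to _    = sym (to refl)
  ≡-from-true⇔true {false} {true}  _ from = from refl
  ≡-from-true⇔true {false} {false} _ _    = refl

  all-true⁻ : ∀ {A : Set} (f : A → Bool) xs → all f xs ≡ true → ∀ {x} → x ∈ xs → f x ≡ true
  all-true⁻ f (y ∷ xs) h (here refl) = proj₁ (∧-true⁻ {f y} h)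
  all-true⁻ f (y ∷ xs) h (there x∈) = all-true⁻ f xs (proj₂ (∧-true⁻ {f y} h)) x∈

  all-true⁺ : ∀ {A : Set} (f : A → Bool) xs → (∀ {x} → x ∈ xs → f x ≡ true) → all f xs ≡ true
  all-true⁺ f []       h = refl
  all-true⁺ f (y ∷ xs) h = ∧-true⁺ (h (here refl)) (all-true⁺ f xs (h ∘ there))

  bit : Bool → ℕ
  bit b = if b then 1 else 0

  module _ {A : Set} where

    filterᵇ : (A → Bool) → List A → List A
    filterᵇ f = filter (λ x → f x Bool.≟ true)

    count : (A → Bool) → List A → ℕ
    count f []       = 0
    count f (x ∷ xs) = if f x then suc (count f xs) else count f xs

    filterᵇ-cong : ∀ {f g : A → Bool} xs → (∀ {x} → x ∈ xs → f x ≡ g x) → filterᵇ f xs ≡ filterᵇ g xs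
    filterᵇ-cong [] _ = refl
    filterᵇ-cong {f} {g} (x ∷ xs) f≡g with f x | g x | f≡g (here refl) | filterᵇ-cong xs (f≡g ∘ there)
    ... | true  | .true  | refl | ih = cong (x ∷_) ih
    ... | false | .false | refl | ih = ih

    ∈-filterᵇ⁺ : ∀ {f : A → Bool} {x xs} → x ∈ xs → f x ≡ true → x ∈ filterᵇ f xs
    ∈-filterᵇ⁺ {f} = ∈-filter⁺ (λ y → f y Bool.≟ true)

    ∈-filterᵇ⁻ : ∀ {f : A → Bool} {x} xs → x ∈ filterᵇ f xs → x ∈ xs × f x ≡ true
    ∈-filterᵇ⁻ {f} xs = ∈-filter⁻ (λ y → f y Bool.≟ true) {xs = xs}

    filterᵇ-unique : ∀ (f : A → Bool) {xs} → Unique xs → Unique (filterᵇ f xs)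
    filterᵇ-unique f = Unique.filter⁺ (λ x → f x Bool.≟ true)

    length-filterᵇ : ∀ (f : A → Bool) xs → length (filterᵇ f xs) ≡ count f xs
    length-filterᵇ f [] = refl
    length-filterᵇ f (x ∷ xs) with f x
    ... | true  = cong suc (length-filterᵇ f xs)
    ... | false = length-filterᵇ f xs

    count-cong : ∀ {f g : A → Bool} xs → (∀ {x} → x ∈ xs → f x ≡ g x) → count f xs ≡ count g xs
    count-cong {f} {g} xs f≡g = trans (sym (length-filterᵇ f xs)) (trans (cong length (filterᵇ-cong xs f≡g)) (length-filterᵇ g xs))

    count-∷ : ∀ (f : A → Bool) x xs → count f (x ∷ xs) ≡ bit (f x) + count f xs
    count-∷ f x xs with f x
    ... | true  = refl
    ... | false = refl

    count-false : ∀ xs → count (λ _ → false) xs ≡ 0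
    count-false []       = refl
    count-false (x ∷ xs) = count-false xs

    count-↭ : ∀ (f : A → Bool) {xs ys} → xs ↭ ys → count f xs ≡ count f ys
    count-↭ f {xs} {ys} xs↭ys =
      trans (sym (length-filterᵇ f xs)) (trans (↭-length (filter-↭ (λ x → f x Bool.≟ true) xs↭ys)) (length-filterᵇ f ys))

    count-++ : ∀ (f : A → Bool) xs ys → count f (xs ++ ys) ≡ count f xs + count f ys
    count-++ f []       ys = refl
    count-++ f (x ∷ xs) ys with f x
    ... | true  = cong suc (count-++ f xs ys)
    ... | false = count-++ f xs ys

    length-filter-filterᵇ : ∀ (f g : A → Bool) xs →
                            length (filter (λ x → g x Bool.≟ false) (filterᵇ f xs)) ≡ count (λ x → f x ∧ not (g x)) xs
    length-filter-filterᵇ f g [] = refl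
    length-filter-filterᵇ f g (x ∷ xs) with f x
    ... | false = length-filter-filterᵇ f g xs
    ... | true with g x
    ...   | true  = length-filter-filterᵇ f g xs
    ...   | false = cong suc (length-filter-filterᵇ f g xs)

    sublists-⊆ : ∀ {ys : List A} xs → ys ∈ sublists xs → ∀ {z} → z ∈ ys → z ∈ xs
    sublists-⊆ []       (here refl) ()
    sublists-⊆ (x ∷ xs) ys∈ z∈ with ∈-++⁻ (map (x ∷_) (sublists xs)) ys∈
    ... | inj₂ ys∈′ = there (sublists-⊆ xs ys∈′ z∈)
    ... | inj₁ x∷ys∈ with ∈-map⁻ (x ∷_) x∷ys∈
    ... | ys′ , ys′∈ , refl with z∈
    ... | here refl = here refl
    ... | there z∈′ = there (sublists-⊆ xs ys′∈ z∈′)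

    filterᵇ∈sublists : ∀ (f : A → Bool) xs → filterᵇ f xs ∈ sublists xs
    filterᵇ∈sublists f []       = here refl
    filterᵇ∈sublists f (x ∷ xs) with f x
    ... | true  = ∈-++⁺ˡ (∈-map⁺ (x ∷_) (filterᵇ∈sublists f xs))
    ... | false = ∈-++⁺ʳ (map (x ∷_) (sublists xs)) (filterᵇ∈sublists f xs)

    sublists-unique : ∀ {xs : List A} → Unique xs → Unique (sublists xs)
    sublists-unique {[]}     _          = [] ∷ []
    sublists-unique {x ∷ xs} (x∉ ∷ uxs) =
      Unique.++⁺ (Unique.map⁺ (λ { refl → refl }) (sublists-unique uxs)) (sublists-unique uxs) disjoint
      where
      disjoint : ∀ {ys} → ys ∈ map (x ∷_) (sublists xs) × ys ∈ sublists xs → ⊥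
      disjoint (p , q) with ∈-map⁻ (x ∷_) p
      ... | _ , _ , refl = All.lookup x∉ (sublists-⊆ xs q (here refl)) refl

  count-map : ∀ {A B : Set} (f : B → Bool) (g : A → B) xs → count f (map g xs) ≡ count (f ∘ g) xs
  count-map f g []       = refl
  count-map f g (x ∷ xs) with f (g x)
  ... | true  = cong suc (count-map f g xs)
  ... | false = count-map f g xs

  count-concatMap : ∀ {A B : Set} (f : B → Bool) (g : A → List B) xs → count f (concatMap g xs) ≡ sum (map (count f ∘ g) xs)
  count-concatMap f g []       = refl
  count-concatMap f g (x ∷ xs) = trans (count-++ f (g x) (concatMap g xs)) (cong (count f (g x) +_) (count-concatMap f g xs))

  concatMap-unique : ∀ {A B : Set} (f : A → List B) {xs} → Unique xs → (∀ {x} → x ∈ xs → Unique (f x)) →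
                     (∀ {x x′ y} → x ∈ xs → x′ ∈ xs → y ∈ f x → y ∈ f x′ → x ≡ x′) → Unique (concatMap f xs)
  concatMap-unique f {[]}     _          _     _        = []
  concatMap-unique f {x ∷ xs} (x∉ ∷ uxs) u-f f-disjoint =
    Unique.++⁺ (u-f (here refl)) (concatMap-unique f uxs (u-f ∘ there) (λ p q → f-disjoint (there p) (there q)))
      (λ (y∈fx , y∈rest) → let x′ , x′∈ , y∈fx′ = find (∈-concatMap⁻ f y∈rest)
                           in All.lookup x∉ x′∈ (f-disjoint (here refl) (there x′∈) y∈fx y∈fx′))

  map-unique : ∀ {A B : Set} (f : A → B) {xs} → Unique xs → (∀ {x y} → x ∈ xs → y ∈ xs → f x ≡ f y → x ≡ y) → Unique (map f xs)
  map-unique f {[]}     _          _   = []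
  map-unique f {x ∷ xs} (x∉ ∷ uxs) inj =
    All.tabulate (λ y∈ fx≡y → let y , y∈xs , eq = ∈-map⁻ f y∈ in All.lookup x∉ y∈xs (inj (here refl) (there y∈xs) (trans fx≡y eq)))
      ∷ map-unique f uxs (λ p q → inj (there p) (there q))

  map-const-∈ : ∀ {A B : Set} {f : A → B} {b} xs → (∀ {x} → x ∈ xs → f x ≡ b) → map f xs ≡ replicate (length xs) b
  map-const-∈ []       _    = refl
  map-const-∈ (x ∷ xs) f≡b = cong₂ _∷_ (f≡b (here refl)) (map-const-∈ xs (f≡b ∘ there))

  module BoolMembership {A : Set} (_==_ : A → A → Bool)
    (==⇒≡ : ∀ {x y} → x == y ≡ true → x ≡ y) (==-refl : ∀ x → x == x ≡ true) where

    ≢⇒==false : ∀ {x y} → x ≢ y → x == y ≡ false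
    ≢⇒==false {x} {y} x≢y with x == y in eq
    ... | true  = ⊥-elim (x≢y (==⇒≡ eq))
    ... | false = refl

    private
      keep-other : ∀ (f : A → Bool) {x y} → y ≢ x → f y ∧ not (y == x) ≡ f y
      keep-other f {x} {y} y≢x rewrite ≢⇒==false y≢x = ∧-identityʳ (f y)

    any==⇒∈ : ∀ {x} xs → any (x ==_) xs ≡ true → x ∈ xs
    any==⇒∈ {x} (y ∷ xs) h with x == y in eq
    ... | true  = here (==⇒≡ eq)
    ... | false = there (any==⇒∈ xs h)

    ∈⇒any== : ∀ {x xs} → x ∈ xs → any (x ==_) xs ≡ true
    ∈⇒any== {x} (here refl) rewrite ==-refl x = refl
    ∈⇒any== {x} {y ∷ xs} (there x∈) with x == y
    ... | true  = refl
    ... | false = ∈⇒any== x∈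

    ∉⇒any==false : ∀ {x} xs → x ∉ xs → any (x ==_) xs ≡ false
    ∉⇒any==false {x} xs x∉ with any (x ==_) xs in eq
    ... | true  = ⊥-elim (x∉ (any==⇒∈ xs eq))
    ... | false = refl

    count-without : ∀ (f : A → Bool) {x} xs → Unique xs → x ∈ xs →
                    count f xs ≡ count (λ y → f y ∧ not (y == x)) xs + bit (f x)
    count-without f {x} (x ∷ xs) (x∉ ∷ uxs) (here refl) = begin
      count f (x ∷ xs)                 ≡⟨ count-∷ f x xs ⟩
      bit (f x) + count f xs           ≡⟨ ℕₚ.+-comm (bit (f x)) _ ⟩
      count f xs + bit (f x)           ≡⟨ cong₂ (λ b c → bit b + c + bit (f x)) x-excluded
                                                (count-cong xs (λ z∈ → keep-other f (λ z≡x → All.lookup x∉ z∈ (sym z≡x)))) ⟨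
      bit g-x + count g xs + bit (f x) ≡⟨ cong (_+ bit (f x)) (count-∷ g x xs) ⟨
      count g (x ∷ xs) + bit (f x)     ∎
      where
      open ≡-Reasoning
      g = λ y → f y ∧ not (y == x)
      g-x = f x ∧ not (x == x)
      x-excluded : g-x ≡ false
      x-excluded = trans (cong (λ t → f x ∧ not t) (==-refl x)) (∧-zeroʳ (f x))
    count-without f {x} (y ∷ xs) (y∉ ∷ uxs) (there x∈) = begin
      count f (y ∷ xs)                          ≡⟨ count-∷ f y xs ⟩
      bit (f y) + count f xs                    ≡⟨ cong (bit (f y) +_) (count-without f xs uxs x∈) ⟩
      bit (f y) + (count g xs + bit (f x))      ≡⟨ ℕₚ.+-assoc (bit (f y)) _ _ ⟨
      bit (f y) + count g xs + bit (f x)        ≡⟨ cong (λ b → bit b + count g xs + bit (f x)) (keep-other f (All.lookup y∉ x∈)) ⟨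
      bit (g y) + count g xs + bit (f x)        ≡⟨ cong (_+ bit (f x)) (count-∷ g y xs) ⟨
      count g (y ∷ xs) + bit (f x)              ∎
      where
      open ≡-Reasoning
      g = λ z → f z ∧ not (z == x)

    sublist≡filterᵇ : ∀ {ys} xs → Unique xs → ys ∈ sublists xs → ys ≡ filterᵇ (λ z → any (z ==_) ys) xs
    sublist≡filterᵇ []       _          (here refl) = refl
    sublist≡filterᵇ {ys} (x ∷ xs) (x∉ ∷ uxs) ys∈ with ∈-++⁻ (map (x ∷_) (sublists xs)) ys∈
    ... | inj₂ ys∈′ = trans (sublist≡filterᵇ xs uxs ys∈′) (sym skip-x)
      where
      x∉ys : x ∉ ys
      x∉ys x∈ = All.lookup x∉ (sublists-⊆ xs ys∈′ x∈) refl
      skip-x : filterᵇ (λ z → any (z ==_) ys) (x ∷ xs) ≡ filterᵇ (λ z → any (z ==_) ys) xs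
      skip-x rewrite ∉⇒any==false ys x∉ys = refl
    ... | inj₁ x∷ys∈ with ∈-map⁻ (x ∷_) x∷ys∈
    ... | ys′ , ys′∈ , refl rewrite ==-refl x =
      cong (x ∷_) (trans (sublist≡filterᵇ xs uxs ys′∈) (filterᵇ-cong {f = λ z → any (z ==_) ys′} xs other-than-x))
      where
      other-than-x : ∀ {z} → z ∈ xs → any (z ==_) ys′ ≡ ((z == x) ∨ any (z ==_) ys′)
      other-than-x {z} z∈ rewrite ≢⇒==false {z} {x} (λ z≡x → All.lookup x∉ z∈ (sym z≡x)) = refl

  -- Blocks of [±n]

  contains : ∀ {n} → Bool → Fin n → Block n → Bool
  contains true  i (P , N) = lookup P i
  contains false i (P , N) = lookup N i

  ∅ᴮ : ∀ {n} → Block n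
  ∅ᴮ {n} = Vec.replicate n false , Vec.replicate n false

  contains-negB : ∀ {n} s i (B : Block n) → contains s i (negB B) ≡ contains (not s) i B
  contains-negB true  i B = refl
  contains-negB false i B = refl

  contains-∅ᴮ : ∀ {n} s (i : Fin n) → contains s i ∅ᴮ ≡ false
  contains-∅ᴮ true  i = Vecₚ.lookup-replicate i false
  contains-∅ᴮ false i = Vecₚ.lookup-replicate i false

  orV-true⁻ : ∀ {n} (v : Vec Bool n) → orV v ≡ true → ∃ λ i → lookup v i ≡ true
  orV-true⁻ (true  ∷ v) _ = zero , refl
  orV-true⁻ (false ∷ v) h = let i , vᵢ = orV-true⁻ v h in suc i , vᵢ

  orV-true⁺ : ∀ {n} (v : Vec Bool n) i → lookup v i ≡ true → orV v ≡ true
  orV-true⁺ (x ∷ v) zero    refl = refl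
  orV-true⁺ (x ∷ v) (suc i) vᵢ   = ∨-true⁺ʳ {x} (orV-true⁺ v i vᵢ)

  orV-false⁻ : ∀ {n} (v : Vec Bool n) → orV v ≡ false → v ≡ Vec.replicate n false
  orV-false⁻ []          _ = refl
  orV-false⁻ (false ∷ v) h = cong (false ∷_) (orV-false⁻ v h)

  orV-replicate : ∀ n → orV (Vec.replicate n false) ≡ false
  orV-replicate zero    = refl
  orV-replicate (suc n) = orV-replicate n

  andV-true⁻ : ∀ {n} (v : Vec Bool n) → andV v ≡ true → ∀ i → lookup v i ≡ true
  andV-true⁻ (true ∷ v) _ zero    = refl
  andV-true⁻ (true ∷ v) h (suc i) = andV-true⁻ v h i

  andV-true⁺ : ∀ {n} (v : Vec Bool n) → (∀ i → lookup v i ≡ true) → andV v ≡ true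
  andV-true⁺ []      _ = refl
  andV-true⁺ (x ∷ v) h rewrite h zero = andV-true⁺ v (h ∘ suc)

  eqVec⇒≡ : ∀ {n} {u v : Vec Bool n} → eqVec u v ≡ true → u ≡ v
  eqVec⇒≡ {u = []}        {[]}        _ = refl
  eqVec⇒≡ {u = true  ∷ u} {true  ∷ v} h = cong (true ∷_) (eqVec⇒≡ h)
  eqVec⇒≡ {u = false ∷ u} {false ∷ v} h = cong (false ∷_) (eqVec⇒≡ h)

  eqVec-refl : ∀ {n} (u : Vec Bool n) → eqVec u u ≡ true
  eqVec-refl []          = refl
  eqVec-refl (true  ∷ u) = eqVec-refl u
  eqVec-refl (false ∷ u) = eqVec-refl u

  eqBlock⇒≡ : ∀ {n} {B B′ : Block n} → eqBlock B B′ ≡ true → B ≡ B′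
  eqBlock⇒≡ {B = P , N} {P′ , N′} h =
    let P≡ , N≡ = ∧-true⁻ {eqVec P P′} h in cong₂ _,_ (eqVec⇒≡ P≡) (eqVec⇒≡ N≡)

  eqBlock-refl : ∀ {n} (B : Block n) → eqBlock B B ≡ true
  eqBlock-refl (P , N) rewrite eqVec-refl P = eqVec-refl N

  module BlockMembership {n : ℕ} = BoolMembership {Block n} eqBlock eqBlock⇒≡ eqBlock-refl
  open BlockMembership public using (≢⇒==false; any==⇒∈; ∈⇒any==)

  nonemptyB⇒∃ : ∀ {n} (B : Block n) → nonemptyB B ≡ true → ∃₂ λ s i → contains s i B ≡ true
  nonemptyB⇒∃ (P , N) h with ∨-true⁻ {orV P} h
  ... | inj₁ P≢∅ = let i , Pᵢ = orV-true⁻ P P≢∅ in true , i , Pᵢ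
  ... | inj₂ N≢∅ = let i , Nᵢ = orV-true⁻ N N≢∅ in false , i , Nᵢ

  ∃⇒nonemptyB : ∀ {n} (B : Block n) s i → contains s i B ≡ true → nonemptyB B ≡ true
  ∃⇒nonemptyB (P , N) true  i h = ∨-true⁺ˡ (orV-true⁺ P i h)
  ∃⇒nonemptyB (P , N) false i h = ∨-true⁺ʳ {orV P} (orV-true⁺ N i h)

  nonemptyB-false⁻ : ∀ {n} (B : Block n) → nonemptyB B ≡ false → B ≡ ∅ᴮ
  nonemptyB-false⁻ (P , N) h with orV P in P≡∅ | orV N in N≡∅
  nonemptyB-false⁻ (P , N) h | false | false = cong₂ _,_ (orV-false⁻ P P≡∅) (orV-false⁻ N N≡∅)

  nonemptyB-∅ᴮ : ∀ {n} → nonemptyB (∅ᴮ {n}) ≡ false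
  nonemptyB-∅ᴮ {n} = cong₂ _∨_ (orV-replicate n) (orV-replicate n)

  nonemptyB-negB : ∀ {n} (B : Block n) → nonemptyB B ≡ true → nonemptyB (negB B) ≡ true
  nonemptyB-negB B h =
    let s , i , Bᵢ = nonemptyB⇒∃ B h
    in ∃⇒nonemptyB (negB B) (not s) i
         (trans (contains-negB (not s) i B) (subst (λ t → contains t i B ≡ true) (sym (not-involutive s)) Bᵢ))

  lookup-zipWith-∧ : ∀ {n} (u v : Vec Bool n) i → lookup u i ≡ true → lookup v i ≡ true → lookup (zipWith _∧_ u v) i ≡ true
  lookup-zipWith-∧ u v i uᵢ vᵢ = trans (Vecₚ.lookup-zipWith _∧_ i u v) (cong₂ _∧_ uᵢ vᵢ)

  lookup-zipWith-∧⁻ : ∀ {n} (u v : Vec Bool n) i → lookup (zipWith _∧_ u v) i ≡ true → lookup u i ≡ true × lookup v i ≡ true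
  lookup-zipWith-∧⁻ u v i e = ∧-true⁻ (trans (sym (Vecₚ.lookup-zipWith _∧_ i u v)) e)

  disjointB⇒ : ∀ {n} (B B′ : Block n) s i → disjointB B B′ ≡ true → contains s i B ≡ true → contains s i B′ ≡ true → ⊥
  disjointB⇒ (P , N) (P′ , N′) true i h Bᵢ B′ᵢ
    rewrite orV-true⁺ (zipWith _∧_ P P′) i (lookup-zipWith-∧ P P′ i Bᵢ B′ᵢ) = true≢false (sym h)
  disjointB⇒ (P , N) (P′ , N′) false i h Bᵢ B′ᵢ
    rewrite orV-true⁺ (zipWith _∧_ N N′) i (lookup-zipWith-∧ N N′ i Bᵢ B′ᵢ) | ∨-zeroʳ (orV (zipWith _∧_ P P′)) = true≢false (sym h)

  disjointB⇐ : ∀ {n} (B B′ : Block n) → (∀ s i → contains s i B ≡ true → contains s i B′ ≡ true → ⊥) → disjointB B B′ ≡ true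
  disjointB⇐ (P , N) (P′ , N′) h with orV (zipWith _∧_ P P′) in PP′ | orV (zipWith _∧_ N N′) in NN′
  ... | false | false = refl
  ... | true  | _     = let i , e = orV-true⁻ (zipWith _∧_ P P′) PP′ ; Pᵢ , P′ᵢ = lookup-zipWith-∧⁻ P P′ i e
                        in ⊥-elim (h true i Pᵢ P′ᵢ)
  ... | false | true  = let i , e = orV-true⁻ (zipWith _∧_ N N′) NN′ ; Nᵢ , N′ᵢ = lookup-zipWith-∧⁻ N N′ i e
                        in ⊥-elim (h false i Nᵢ N′ᵢ)

  isZeroBlock⇒ : ∀ {n} (B : Block n) → isZeroBlock B ≡ true → negB B ≡ B
  isZeroBlock⇒ B = eqBlock⇒≡

  isZeroBlock⇐ : ∀ {n} (B : Block n) → negB B ≡ B → isZeroBlock B ≡ true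
  isZeroBlock⇐ B eq = subst (λ X → eqBlock X B ≡ true) (sym eq) (eqBlock-refl B)

  allVecs-complete : ∀ {n} (v : Vec Bool n) → v ∈ allVecs n
  allVecs-complete []      = here refl
  allVecs-complete (b ∷ v) = ∈-concatMap⁺ _ (lose (allVecs-complete v) (head∈ b))
    where
    head∈ : ∀ b → (b ∷ v) ∈ (true ∷ v) ∷ (false ∷ v) ∷ []
    head∈ true  = here refl
    head∈ false = there (here refl)

  allVecs-unique : ∀ n → Unique (allVecs n)
  allVecs-unique zero    = [] ∷ []
  allVecs-unique (suc n) = concatMap-unique _ (allVecs-unique n) (λ _ → ((λ ()) ∷ []) ∷ [] ∷ []) same-tail
    where
    same-tail : ∀ {v v′ : Vec Bool n} {w} → v ∈ allVecs n → v′ ∈ allVecs n →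
                w ∈ (true ∷ v) ∷ (false ∷ v) ∷ [] → w ∈ (true ∷ v′) ∷ (false ∷ v′) ∷ [] → v ≡ v′
    same-tail _ _ (here refl)         (here refl)         = refl
    same-tail _ _ (here refl)         (there (here ()))
    same-tail _ _ (there (here refl)) (here ())
    same-tail _ _ (there (here refl)) (there (here refl)) = refl

  allBlocks-complete : ∀ {n} (B : Block n) → B ∈ allBlocks n
  allBlocks-complete (P , N) = ∈-cartesianProduct⁺ (allVecs-complete P) (allVecs-complete N)

  allBlocks-unique : ∀ n → Unique (allBlocks n)
  allBlocks-unique n = Unique.cartesianProduct⁺ (allVecs-unique n) (allVecs-unique n)

  -- Type B partitions as characteristic functions of their sets of blocks

  length≤1⇒≡ : ∀ {A : Set} {xs : List A} → length xs ≤ 1 → ∀ {x y} → x ∈ xs → y ∈ xs → x ≡ y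
  length≤1⇒≡ {xs = _ ∷ []}    _        (here refl) (here refl) = refl
  length≤1⇒≡ {xs = _ ∷ _ ∷ _} (s≤s ()) _           _

  ≡⇒length≤1 : ∀ {A : Set} {xs : List A} → Unique xs → (∀ {x y} → x ∈ xs → y ∈ xs → x ≡ y) → length xs ≤ 1
  ≡⇒length≤1 {xs = []}         _                 _      = z≤n
  ≡⇒length≤1 {xs = _ ∷ []}     _                 _      = s≤s z≤n
  ≡⇒length≤1 {xs = _ ∷ _ ∷ _} ((x≢y ∷ _) ∷ _) all≡ = ⊥-elim (x≢y (all≡ (here refl) (there (here refl))))

  union : ∀ {n} → Bool → List (Block n) → Vec Bool n
  union true  = unionP
  union false = unionN

  module _ {n : ℕ} where

    lookup-union-∷ : ∀ s (B : Block n) F i → lookup (union s (B ∷ F)) i ≡ contains s i B ∨ lookup (union s F) i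
    lookup-union-∷ true  B F i = Vecₚ.lookup-zipWith _∨_ i (proj₁ B) (unionP F)
    lookup-union-∷ false B F i = Vecₚ.lookup-zipWith _∨_ i (proj₂ B) (unionN F)

    lookup-union-[] : ∀ s (i : Fin n) → lookup (union s []) i ≡ false
    lookup-union-[] true  i = Vecₚ.lookup-replicate i false
    lookup-union-[] false i = Vecₚ.lookup-replicate i false

    union-true⁻ : ∀ s (F : List (Block n)) i → lookup (union s F) i ≡ true → ∃ λ B → B ∈ F × contains s i B ≡ true
    union-true⁻ s []      i h = ⊥-elim (true≢false (trans (sym h) (lookup-union-[] s i)))
    union-true⁻ s (B ∷ F) i h with ∨-true⁻ (trans (sym (lookup-union-∷ s B F i)) h)
    ... | inj₁ Bᵢ = B , here refl , Bᵢ
    ... | inj₂ Fᵢ = let B′ , B′∈ , B′ᵢ = union-true⁻ s F i Fᵢ in B′ , there B′∈ , B′ᵢ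

    union-true⁺ : ∀ s (F : List (Block n)) i {B} → B ∈ F → contains s i B ≡ true → lookup (union s F) i ≡ true
    union-true⁺ s (B ∷ F) i (here refl) Bᵢ = trans (lookup-union-∷ s B F i) (cong (_∨ _) Bᵢ)
    union-true⁺ s (B ∷ F) i (there B′∈) B′ᵢ =
      trans (lookup-union-∷ s B F i) (∨-true⁺ʳ {contains s i B} (union-true⁺ s F i B′∈ B′ᵢ))

    disjointB-sym : (B B′ : Block n) → disjointB B B′ ≡ true → disjointB B′ B ≡ true
    disjointB-sym B B′ d = disjointB⇐ B′ B (λ s i B′ᵢ Bᵢ → disjointB⇒ B B′ s i d Bᵢ B′ᵢ)

    pairwiseDisjoint⇒ : (F : List (Block n)) → pairwiseDisjoint F ≡ true →
                        ∀ {B B′} → B ∈ F → B′ ∈ F → B ≢ B′ → disjointB B B′ ≡ true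
    pairwiseDisjoint⇒ (B ∷ F) h (here refl) (here refl) B≢B′ = ⊥-elim (B≢B′ refl)
    pairwiseDisjoint⇒ (B ∷ F) h (here refl) (there q)   _    = all-true⁻ (disjointB B) F (proj₁ (∧-true⁻ {all (disjointB B) F} h)) q
    pairwiseDisjoint⇒ (B ∷ F) h (there p)   (here refl) _    =
      disjointB-sym B _ (all-true⁻ (disjointB B) F (proj₁ (∧-true⁻ {all (disjointB B) F} h)) p)
    pairwiseDisjoint⇒ (B ∷ F) h (there p)   (there q)   B≢B′ = pairwiseDisjoint⇒ F (proj₂ (∧-true⁻ {all (disjointB B) F} h)) p q B≢B′

    pairwiseDisjoint⇐ : (F : List (Block n)) → Unique F →
                        (∀ {B B′} → B ∈ F → B′ ∈ F → B ≢ B′ → disjointB B B′ ≡ true) → pairwiseDisjoint F ≡ true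
    pairwiseDisjoint⇐ []      _          _ = refl
    pairwiseDisjoint⇐ (B ∷ F) (B∉ ∷ uF) h =
      ∧-true⁺ (all-true⁺ (disjointB B) F (λ q → h (here refl) (there q) (All.lookup B∉ q)))
              (pairwiseDisjoint⇐ F uF (λ p q → h (there p) (there q)))

  record IsTypeBPartition {n : ℕ} (χ : Block n → Bool) : Set where
    field
      nonempty    : ∀ B → χ B ≡ true → nonemptyB B ≡ true
      disjoint    : ∀ B B′ s i → χ B ≡ true → χ B′ ≡ true → contains s i B ≡ true → contains s i B′ ≡ true → B ≡ B′
      covering    : ∀ s i → ∃ λ B → χ B ≡ true × contains s i B ≡ true
      negB-closed : ∀ B → χ B ≡ true → χ (negB B) ≡ true
      zero-unique : ∀ B B′ → χ B ≡ true → χ B′ ≡ true → negB B ≡ B → negB B′ ≡ B′ → B ≡ B′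

  module _ {n : ℕ} (F : List (Block n)) where

    private
      χ : Block n → Bool
      χ B = memB B F

    zeroBlocks-≤1 : isTypeBPartition F ≡ true → length (filterᵇ isZeroBlock F) ≤ 1
    zeroBlocks-≤1 h with length (filterᵇ isZeroBlock F)
    ... | zero        = z≤n
    ... | suc zero    = s≤s z≤n
    ... | suc (suc _) = ⊥-elim (true≢false (sym
          (proj₂ (∧-true⁻ {all (λ b → memB (negB b) F) F}
          (proj₂ (∧-true⁻ {andV (unionN F)}
          (proj₂ (∧-true⁻ {andV (unionP F)}
          (proj₂ (∧-true⁻ {pairwiseDisjoint F}
          (proj₂ (∧-true⁻ {all nonemptyB F} h))))))))))))

    isTypeBPartition⇒ : Unique F → isTypeBPartition F ≡ true → IsTypeBPartition χ
    isTypeBPartition⇒ uF h = record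
      { nonempty    = λ B χB → all-true⁻ nonemptyB F all-nonempty (any==⇒∈ {x = B} F χB)
      ; disjoint    = disjoint
      ; covering    = covering
      ; negB-closed = λ B χB → all-true⁻ (λ b → memB (negB b) F) F all-negB (any==⇒∈ {x = B} F χB)
      ; zero-unique = λ B B′ χB χB′ zB zB′ →
          length≤1⇒≡ (zeroBlocks-≤1 h) (∈-filterᵇ⁺ (any==⇒∈ {x = B} F χB) (isZeroBlock⇐ B zB))
                                       (∈-filterᵇ⁺ (any==⇒∈ {x = B′} F χB′) (isZeroBlock⇐ B′ zB′))
      }
      where
      h₁ = ∧-true⁻ {all nonemptyB F} h
      all-nonempty = proj₁ h₁
      h₂ = ∧-true⁻ {pairwiseDisjoint F} (proj₂ h₁)
      h₃ = ∧-true⁻ {andV (unionP F)} (proj₂ h₂)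
      h₄ = ∧-true⁻ {andV (unionN F)} (proj₂ h₃)
      h₅ = ∧-true⁻ {all (λ b → memB (negB b) F) F} (proj₂ h₄)
      all-negB = proj₁ h₅
      covered : ∀ s → andV (union s F) ≡ true
      covered true  = proj₁ h₃
      covered false = proj₁ h₄
      disjoint : ∀ B B′ s i → χ B ≡ true → χ B′ ≡ true → contains s i B ≡ true → contains s i B′ ≡ true → B ≡ B′
      disjoint B B′ s i χB χB′ Bᵢ B′ᵢ with eqBlock B B′ in B==B′
      ... | true  = eqBlock⇒≡ B==B′
      ... | false = ⊥-elim (disjointB⇒ B B′ s i
                              (pairwiseDisjoint⇒ F (proj₁ h₂) (any==⇒∈ {x = B} F χB) (any==⇒∈ {x = B′} F χB′) B≢B′) Bᵢ B′ᵢ)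
        where
        B≢B′ : B ≢ B′
        B≢B′ refl = true≢false (trans (sym (eqBlock-refl B)) B==B′)
      covering : ∀ s i → ∃ λ B → χ B ≡ true × contains s i B ≡ true
      covering s i = let B , B∈ , Bᵢ = union-true⁻ s F i (andV-true⁻ (union s F) (covered s) i) in B , ∈⇒any== B∈ , Bᵢ

    isTypeBPartition-intro : all nonemptyB F ≡ true → pairwiseDisjoint F ≡ true → andV (unionP F) ≡ true → andV (unionN F) ≡ true →
                             all (λ b → memB (negB b) F) F ≡ true → length (filterᵇ isZeroBlock F) ≤ 1 → isTypeBPartition F ≡ true
    isTypeBPartition-intro h₁ h₂ h₃ h₄ h₅ zeros≤1 rewrite h₁ | h₂ | h₃ | h₄ | h₅
      with length (filterᵇ isZeroBlock F) | zeros≤1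
    ... | zero        | _        = refl
    ... | suc zero    | _        = refl
    ... | suc (suc _) | s≤s ()

    isTypeBPartition⇐ : Unique F → IsTypeBPartition χ → isTypeBPartition F ≡ true
    isTypeBPartition⇐ uF P = isTypeBPartition-intro
      (all-true⁺ nonemptyB F (λ {B} B∈ → nonempty B (∈⇒any== B∈)))
      (pairwiseDisjoint⇐ F uF (λ {B} {B′} B∈ B′∈ B≢B′ →
        disjointB⇐ B B′ (λ s i Bᵢ B′ᵢ → B≢B′ (disjoint B B′ s i (∈⇒any== B∈) (∈⇒any== B′∈) Bᵢ B′ᵢ))))
      (andV-true⁺ (unionP F) (covered true))
      (andV-true⁺ (unionN F) (covered false))
      (all-true⁺ (λ b → memB (negB b) F) F (λ {B} B∈ → negB-closed B (∈⇒any== B∈)))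
      (≡⇒length≤1 (filterᵇ-unique isZeroBlock uF) λ {B} {B′} B∈ B′∈ →
        let B∈F , zB = ∈-filterᵇ⁻ F B∈ ; B′∈F , zB′ = ∈-filterᵇ⁻ F B′∈
        in zero-unique B B′ (∈⇒any== B∈F) (∈⇒any== B′∈F) (isZeroBlock⇒ B zB) (isZeroBlock⇒ B′ zB′))
      where
      open IsTypeBPartition P
      covered : ∀ s i → lookup (union s F) i ≡ true
      covered s i = let B , χB , Bᵢ = covering s i in union-true⁺ s F i (any==⇒∈ {x = B} F χB) Bᵢ

  IsTypeBPartition-cong : ∀ {n} {χ χ′ : Block n → Bool} → (∀ B → χ B ≡ χ′ B) → IsTypeBPartition χ → IsTypeBPartition χ′
  IsTypeBPartition-cong {χ = χ} {χ′} χ≡χ′ P = record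
    { nonempty    = λ B χ′B → nonempty B (back B χ′B)
    ; disjoint    = λ B B′ s i χ′B χ′B′ → disjoint B B′ s i (back B χ′B) (back B′ χ′B′)
    ; covering    = λ s i → let B , χB , Bᵢ = covering s i in B , trans (sym (χ≡χ′ B)) χB , Bᵢ
    ; negB-closed = λ B χ′B → trans (sym (χ≡χ′ (negB B))) (negB-closed B (back B χ′B))
    ; zero-unique = λ B B′ χ′B χ′B′ → zero-unique B B′ (back B χ′B) (back B′ χ′B′)
    }
    where
    open IsTypeBPartition P
    back : ∀ B → χ′ B ≡ true → χ B ≡ true
    back B = trans (χ≡χ′ B)

  module _ {n : ℕ} where

    blocks : (Block n → Bool) → List (Block n)
    blocks χ = filterᵇ χ (allBlocks n)

    indicator : List (Block n) → Block n → Bool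
    indicator F B = memB B F

    indicator-blocks : ∀ χ B → indicator (blocks χ) B ≡ χ B
    indicator-blocks χ B = ≡-from-true⇔true
      (λ h → proj₂ (∈-filterᵇ⁻ (allBlocks n) (any==⇒∈ {x = B} (blocks χ) h)))
      (λ h → ∈⇒any== (∈-filterᵇ⁺ (allBlocks-complete B) h))

    typeBPartitions-unique : Unique (typeBPartitions n)
    typeBPartitions-unique = filterᵇ-unique isTypeBPartition (sublists-unique (allBlocks-unique n))

    typeBPartition≡blocks : ∀ {F} → F ∈ typeBPartitions n → F ≡ blocks (indicator F)
    typeBPartition≡blocks {F} F∈ =
      BlockMembership.sublist≡filterᵇ (allBlocks n) (allBlocks-unique n) (proj₁ (∈-filterᵇ⁻ (sublists (allBlocks n)) F∈))

    typeBPartition-unique : ∀ {F} → F ∈ typeBPartitions n → Unique F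
    typeBPartition-unique {F} F∈ =
      subst Unique (sym (typeBPartition≡blocks F∈)) (filterᵇ-unique (indicator F) (allBlocks-unique n))

    typeBPartition-isTypeB : ∀ {F} → F ∈ typeBPartitions n → IsTypeBPartition (indicator F)
    typeBPartition-isTypeB {F} F∈ =
      isTypeBPartition⇒ F (typeBPartition-unique F∈) (proj₂ (∈-filterᵇ⁻ (sublists (allBlocks n)) F∈))

    blocks∈typeBPartitions : ∀ {χ} → IsTypeBPartition χ → blocks χ ∈ typeBPartitions n
    blocks∈typeBPartitions {χ} P = ∈-filterᵇ⁺ (filterᵇ∈sublists χ (allBlocks n))
      (isTypeBPartition⇐ (blocks χ) (filterᵇ-unique χ (allBlocks-unique n))
        (IsTypeBPartition-cong (λ B → sym (indicator-blocks χ B)) P))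

  -- Adjoining the new pair ±1

  false≢true : false ≢ true
  false≢true ()

  ≢⇒not-eqBlock : ∀ {n} {B B′ : Block n} → B ≢ B′ → not (eqBlock B B′) ≡ true
  ≢⇒not-eqBlock B≢B′ = cong not (≢⇒==false B≢B′)

  not-eqBlock⇒≢ : ∀ {n} {B B′ : Block n} → not (eqBlock B B′) ≡ true → B ≢ B′
  not-eqBlock⇒≢ {B = B} h refl = true≢false (trans (sym (eqBlock-refl B)) (not-true⁻ h))

  -- The new element of [m+1] is 1, because allVecs enumerates by the first coordinate: consB p q B
  -- contains +1 iff p, -1 iff q, and ±(i+2) iff B contains ±(i+1).
  consB : ∀ {m} → Bool → Bool → Block m → Block (suc m)
  consB p q (P , N) = p ∷ P , q ∷ N

  tailB : ∀ {m} → Block (suc m) → Block m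
  tailB (P , N) = Vec.tail P , Vec.tail N

  contains-consB : ∀ {m} s j p q (B : Block m) → contains s (suc j) (consB p q B) ≡ contains s j B
  contains-consB true  j p q B = refl
  contains-consB false j p q B = refl

  addOne : ∀ {m} → Bool → Block m → Block (suc m)
  addOne = consB true

  liftB : ∀ {m} → Block m → Block (suc m)
  liftB = consB false false

  contains-liftB-zero : ∀ {m} s (B : Block m) → contains s zero (liftB B) ≡ false
  contains-liftB-zero true  B = refl
  contains-liftB-zero false B = refl

  -- A type B partition of [m+1] arises from one of [m] by placing the new pair ±1 according to a
  -- choice (b , B₀): b = true puts ±1 into the zero block B₀ (B₀ = ∅ᴮ if there is none, creating
  -- the zero block {±1}); b = false puts +1 into B₀ and -1 into -B₀, where B₀ = ∅ᴮ creates the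
  -- new pair of blocks {+1}, {-1}.
  extend : ∀ {m} → (Block m → Bool) → Bool × Block m → Block (suc m) → Bool
  extend χ (b , B₀) (true  ∷ P , true  ∷ N) = b ∧ eqBlock (P , N) B₀
  extend χ (b , B₀) (true  ∷ P , false ∷ N) = not b ∧ eqBlock (P , N) B₀
  extend χ (b , B₀) (false ∷ P , true  ∷ N) = not b ∧ eqBlock (P , N) (negB B₀)
  extend χ (b , B₀) (false ∷ P , false ∷ N) = χ (P , N) ∧ (not (eqBlock (P , N) B₀) ∧ not (eqBlock (P , N) (negB B₀)))

  ValidChoice : ∀ {m} → (Block m → Bool) → Bool × Block m → Set
  ValidChoice χ (true  , B₀) = negB B₀ ≡ B₀ × (χ B₀ ≡ true ⊎ (B₀ ≡ ∅ᴮ × (∀ B → χ B ≡ true → negB B ≢ B)))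
  ValidChoice χ (false , B₀) = B₀ ≡ ∅ᴮ ⊎ (χ B₀ ≡ true × negB B₀ ≢ B₀)

  extend-cong : ∀ {m} {χ χ′ : Block m → Bool} → (∀ B → χ B ≡ χ′ B) → ∀ c B → extend χ c B ≡ extend χ′ c B
  extend-cong χ≡χ′ c (true  ∷ P , true  ∷ N) = refl
  extend-cong χ≡χ′ c (true  ∷ P , false ∷ N) = refl
  extend-cong χ≡χ′ c (false ∷ P , true  ∷ N) = refl
  extend-cong χ≡χ′ c (false ∷ P , false ∷ N) = cong (_∧ _) (χ≡χ′ (P , N))

  ValidChoice-cong : ∀ {m} {χ χ′ : Block m → Bool} → (∀ B → χ B ≡ χ′ B) → ∀ c → ValidChoice χ c → ValidChoice χ′ c
  ValidChoice-cong χ≡χ′ (true  , B₀) (z , inj₁ χB₀)            = z , inj₁ (trans (sym (χ≡χ′ B₀)) χB₀)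
  ValidChoice-cong χ≡χ′ (true  , B₀) (z , inj₂ (B₀≡∅ , no-zero)) = z , inj₂ (B₀≡∅ , λ B χ′B → no-zero B (trans (χ≡χ′ B) χ′B))
  ValidChoice-cong χ≡χ′ (false , B₀) (inj₁ B₀≡∅)               = inj₁ B₀≡∅
  ValidChoice-cong χ≡χ′ (false , B₀) (inj₂ (χB₀ , nonzero))    = inj₂ (trans (sym (χ≡χ′ B₀)) χB₀ , nonzero)

  module _ {m : ℕ} {χ : Block m → Bool} where

    extend-true⁻ : ∀ b B₀ (B : Block (suc m)) → extend χ (b , B₀) B ≡ true →
                   B ≡ addOne b B₀ ⊎ (b ≡ false × B ≡ negB (addOne b B₀))
                     ⊎ (∃ λ B₁ → B ≡ liftB B₁ × χ B₁ ≡ true × B₁ ≢ B₀ × B₁ ≢ negB B₀)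
    extend-true⁻ b B₀ (true ∷ P , true ∷ N) h with ∧-true⁻ {b} h
    ... | refl , eq with eqBlock⇒≡ {B = P , N} {B₀} eq
    ... | refl = inj₁ refl
    extend-true⁻ false B₀ (true ∷ P , false ∷ N) h with eqBlock⇒≡ {B = P , N} {B₀} h
    ... | refl = inj₁ refl
    extend-true⁻ false B₀ (false ∷ P , true ∷ N) h with eqBlock⇒≡ {B = P , N} {negB B₀} h
    ... | refl = inj₂ (inj₁ (refl , refl))
    extend-true⁻ b B₀ (false ∷ P , false ∷ N) h with ∧-true⁻ {χ (P , N)} h
    ... | χB₁ , rest with ∧-true⁻ {not (eqBlock (P , N) B₀)} rest
    ... | ≢B₀ , ≢-B₀ = inj₂ (inj₂ ((P , N) , refl , χB₁ , not-eqBlock⇒≢ ≢B₀ , not-eqBlock⇒≢ ≢-B₀))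

    extend-addOne : ∀ b B₀ → extend χ (b , B₀) (addOne b B₀) ≡ true
    extend-addOne true  B₀ = eqBlock-refl B₀
    extend-addOne false B₀ = eqBlock-refl B₀

    extend-negB-addOne : ∀ b B₀ → ValidChoice χ (b , B₀) → extend χ (b , B₀) (negB (addOne b B₀)) ≡ true
    extend-negB-addOne true  B₀ (z , _) = subst (λ X → eqBlock (negB B₀) X ≡ true) z (eqBlock-refl (negB B₀))
    extend-negB-addOne false B₀ _       = eqBlock-refl (negB B₀)

    valid-∅ᴮ⊎member : ∀ b B₀ → ValidChoice χ (b , B₀) → B₀ ≡ ∅ᴮ ⊎ χ B₀ ≡ true
    valid-∅ᴮ⊎member true  B₀ (_ , inj₁ χB₀)         = inj₂ χB₀
    valid-∅ᴮ⊎member true  B₀ (_ , inj₂ (B₀≡∅ , _))  = inj₁ B₀≡∅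
    valid-∅ᴮ⊎member false B₀ (inj₁ B₀≡∅)            = inj₁ B₀≡∅
    valid-∅ᴮ⊎member false B₀ (inj₂ (χB₀ , _))       = inj₂ χB₀

    module _ (P : IsTypeBPartition χ) where
      open IsTypeBPartition P

      valid-member≡nonempty : ∀ b B₀ → ValidChoice χ (b , B₀) → χ B₀ ≡ nonemptyB B₀
      valid-member≡nonempty b B₀ v with valid-∅ᴮ⊎member b B₀ v
      ... | inj₂ χB₀ = trans χB₀ (sym (nonempty B₀ χB₀))
      ... | inj₁ refl with χ ∅ᴮ in χ∅
      ...   | true  = ⊥-elim (true≢false (trans (sym (nonempty ∅ᴮ χ∅)) (nonemptyB-∅ᴮ {m})))
      ...   | false = sym (nonemptyB-∅ᴮ {m})

      valid-member≡nonempty-negB : ∀ b B₀ → ValidChoice χ (b , B₀) → χ (negB B₀) ≡ nonemptyB (negB B₀)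
      valid-member≡nonempty-negB b B₀ v with valid-∅ᴮ⊎member b B₀ v
      ... | inj₁ refl = valid-member≡nonempty b B₀ v
      ... | inj₂ χB₀  = let χ-B₀ = negB-closed B₀ χB₀ in trans χ-B₀ (sym (nonempty (negB B₀) χ-B₀))

      private
        member-of-B₀ : ∀ b B₀ → ValidChoice χ (b , B₀) → ∀ s i → contains s i B₀ ≡ true → χ B₀ ≡ true
        member-of-B₀ b B₀ v s i B₀ᵢ with valid-∅ᴮ⊎member b B₀ v
        ... | inj₂ χB₀  = χB₀
        ... | inj₁ refl = ⊥-elim (false≢true (trans (sym (contains-∅ᴮ s i)) B₀ᵢ))

        member-of-negB-B₀ : ∀ b B₀ → ValidChoice χ (b , B₀) → ∀ s i → contains s i (negB B₀) ≡ true → χ (negB B₀) ≡ true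
        member-of-negB-B₀ b B₀ v s i -B₀ᵢ = negB-closed B₀ (member-of-B₀ b B₀ v (not s) i (trans (sym (contains-negB s i B₀)) -B₀ᵢ))

        new-disjoint-negB : ∀ B₀ → ValidChoice χ (false , B₀) → ∀ s i →
                            contains s i (addOne false B₀) ≡ true → contains s i (negB (addOne false B₀)) ≡ true → ⊥
        new-disjoint-negB B₀ v true  zero    _ ()
        new-disjoint-negB B₀ v false zero    () _
        new-disjoint-negB B₀ (inj₁ refl) s (suc j) e _ =
          false≢true (trans (sym (contains-∅ᴮ s j)) (trans (sym (contains-consB s j true false ∅ᴮ)) e))
        new-disjoint-negB B₀ (inj₂ (χB₀ , nonzero)) s (suc j) e e′ =
          nonzero (sym (disjoint B₀ (negB B₀) s j χB₀ (negB-closed B₀ χB₀)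
                         (trans (sym (contains-consB s j true false B₀)) e) (trans (sym (contains-consB s j false true (negB B₀))) e′)))

        new-disjoint-old : ∀ b B₀ → ValidChoice χ (b , B₀) → ∀ B₁ → χ B₁ ≡ true → B₁ ≢ B₀ → ∀ s i →
                           contains s i (addOne b B₀) ≡ true → contains s i (liftB B₁) ≡ true → ⊥
        new-disjoint-old b B₀ v B₁ χB₁ B₁≢B₀ s zero    _ e′ = false≢true (trans (sym (contains-liftB-zero s B₁)) e′)
        new-disjoint-old b B₀ v B₁ χB₁ B₁≢B₀ s (suc j) e e′ =
          let B₀ⱼ = trans (sym (contains-consB s j true b B₀)) e
          in B₁≢B₀ (sym (disjoint B₀ B₁ s j (member-of-B₀ b B₀ v s j B₀ⱼ) χB₁ B₀ⱼ (trans (sym (contains-consB s j false false B₁)) e′)))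

        negB-new-disjoint-old : ∀ b B₀ → ValidChoice χ (b , B₀) → ∀ B₁ → χ B₁ ≡ true → B₁ ≢ negB B₀ → ∀ s i →
                                contains s i (negB (addOne b B₀)) ≡ true → contains s i (liftB B₁) ≡ true → ⊥
        negB-new-disjoint-old b B₀ v B₁ χB₁ B₁≢-B₀ s zero    _ e′ = false≢true (trans (sym (contains-liftB-zero s B₁)) e′)
        negB-new-disjoint-old b B₀ v B₁ χB₁ B₁≢-B₀ s (suc j) e e′ =
          let -B₀ⱼ = trans (sym (contains-consB s j b true (negB B₀))) e
          in B₁≢-B₀ (sym (disjoint (negB B₀) B₁ s j (member-of-negB-B₀ b B₀ v s j -B₀ⱼ) χB₁ -B₀ⱼ
                                   (trans (sym (contains-consB s j false false B₁)) e′)))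

        old-disjoint-old : ∀ B₁ B₂ → χ B₁ ≡ true → χ B₂ ≡ true → ∀ s i →
                           contains s i (liftB B₁) ≡ true → contains s i (liftB B₂) ≡ true → liftB B₁ ≡ liftB B₂
        old-disjoint-old B₁ B₂ χB₁ χB₂ s zero    e _  = ⊥-elim (false≢true (trans (sym (contains-liftB-zero s B₁)) e))
        old-disjoint-old B₁ B₂ χB₁ χB₂ s (suc j) e e′ =
          cong liftB (disjoint B₁ B₂ s j χB₁ χB₂ (trans (sym (contains-consB s j false false B₁)) e) (trans (sym (contains-consB s j false false B₂)) e′))

        new-zero-old-zero : ∀ b B₀ → ValidChoice χ (b , B₀) → negB (addOne b B₀) ≡ addOne b B₀ →
                            ∀ B₁ → χ B₁ ≡ true → B₁ ≢ B₀ → negB B₁ ≡ B₁ → ⊥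
        new-zero-old-zero false B₀ v                        z B₁ χB₁ B₁≢B₀ zB₁ = false≢true (cong (Vec.head ∘ proj₁) z)
        new-zero-old-zero true  B₀ (zB₀ , inj₁ χB₀)         z B₁ χB₁ B₁≢B₀ zB₁ = B₁≢B₀ (sym (zero-unique B₀ B₁ χB₀ χB₁ zB₀ zB₁))
        new-zero-old-zero true  B₀ (zB₀ , inj₂ (_ , no-zero)) z B₁ χB₁ B₁≢B₀ zB₁ = no-zero B₁ χB₁ zB₁

        minus-one-covered : ∀ b B₀ → ValidChoice χ (b , B₀) → ∃ λ B → extend χ (b , B₀) B ≡ true × contains false zero B ≡ true
        minus-one-covered true  B₀ v = addOne true B₀ , extend-addOne true B₀ , refl
        minus-one-covered false B₀ v = negB (addOne false B₀) , extend-negB-addOne false B₀ v , refl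

      extend-isTypeB : ∀ b B₀ → ValidChoice χ (b , B₀) → IsTypeBPartition (extend χ (b , B₀))
      extend-isTypeB b B₀ v = record
        { nonempty = nonempty′ ; disjoint = disjoint′ ; covering = covering′ ; negB-closed = negB-closed′ ; zero-unique = zero-unique′ }
        where
        χ′ = extend χ (b , B₀)

        nonempty′ : ∀ B → χ′ B ≡ true → nonemptyB B ≡ true
        nonempty′ B h with extend-true⁻ b B₀ B h
        ... | inj₁ refl                          = ∃⇒nonemptyB (addOne b B₀) true zero refl
        ... | inj₂ (inj₁ (refl , refl))          = ∃⇒nonemptyB (negB (addOne false B₀)) false zero refl
        ... | inj₂ (inj₂ (B₁ , refl , χB₁ , _ , _)) =
          let s , i , B₁ᵢ = nonemptyB⇒∃ B₁ (nonempty B₁ χB₁)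
          in ∃⇒nonemptyB (liftB B₁) s (suc i) (trans (contains-consB s i false false B₁) B₁ᵢ)

        disjoint′ : ∀ B B′ s i → χ′ B ≡ true → χ′ B′ ≡ true → contains s i B ≡ true → contains s i B′ ≡ true → B ≡ B′
        disjoint′ B B′ s i h h′ e e′ with extend-true⁻ b B₀ B h | extend-true⁻ b B₀ B′ h′
        ... | inj₁ refl | inj₁ refl = refl
        ... | inj₁ refl | inj₂ (inj₁ (refl , refl)) = ⊥-elim (new-disjoint-negB B₀ v s i e e′)
        ... | inj₁ refl | inj₂ (inj₂ (B₁ , refl , χB₁ , B₁≢B₀ , _)) = ⊥-elim (new-disjoint-old b B₀ v B₁ χB₁ B₁≢B₀ s i e e′)
        ... | inj₂ (inj₁ (refl , refl)) | inj₁ refl = ⊥-elim (new-disjoint-negB B₀ v s i e′ e)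
        ... | inj₂ (inj₁ (refl , refl)) | inj₂ (inj₁ (refl , refl)) = refl
        ... | inj₂ (inj₁ (refl , refl)) | inj₂ (inj₂ (B₁ , refl , χB₁ , _ , B₁≢-B₀)) =
          ⊥-elim (negB-new-disjoint-old false B₀ v B₁ χB₁ B₁≢-B₀ s i e e′)
        ... | inj₂ (inj₂ (B₁ , refl , χB₁ , B₁≢B₀ , _)) | inj₁ refl = ⊥-elim (new-disjoint-old b B₀ v B₁ χB₁ B₁≢B₀ s i e′ e)
        ... | inj₂ (inj₂ (B₁ , refl , χB₁ , _ , B₁≢-B₀)) | inj₂ (inj₁ (refl , refl)) =
          ⊥-elim (negB-new-disjoint-old false B₀ v B₁ χB₁ B₁≢-B₀ s i e′ e)
        ... | inj₂ (inj₂ (B₁ , refl , χB₁ , _)) | inj₂ (inj₂ (B₂ , refl , χB₂ , _)) = old-disjoint-old B₁ B₂ χB₁ χB₂ s i e e′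

        covering′ : ∀ s i → ∃ λ B → χ′ B ≡ true × contains s i B ≡ true
        covering′ true  zero = addOne b B₀ , extend-addOne b B₀ , refl
        covering′ false zero = minus-one-covered b B₀ v
        covering′ s (suc j) with covering s j
        ... | B₁ , χB₁ , B₁ⱼ with eqBlock B₁ B₀ in B₁==B₀
        ...   | true = addOne b B₀ , extend-addOne b B₀ ,
                       trans (contains-consB s j true b B₀) (subst (λ X → contains s j X ≡ true) (eqBlock⇒≡ B₁==B₀) B₁ⱼ)
        ...   | false with eqBlock B₁ (negB B₀) in B₁==-B₀
        ...     | true = negB (addOne b B₀) , extend-negB-addOne b B₀ v ,
                         trans (contains-consB s j b true (negB B₀)) (subst (λ X → contains s j X ≡ true) (eqBlock⇒≡ B₁==-B₀) B₁ⱼ)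
        ...     | false = liftB B₁ , ∧-true⁺ χB₁ (∧-true⁺ (cong not B₁==B₀) (cong not B₁==-B₀)) ,
                          trans (contains-consB s j false false B₁) B₁ⱼ

        negB-closed′ : ∀ B → χ′ B ≡ true → χ′ (negB B) ≡ true
        negB-closed′ B h with extend-true⁻ b B₀ B h
        ... | inj₁ refl = extend-negB-addOne b B₀ v
        ... | inj₂ (inj₁ (refl , refl)) = extend-addOne false B₀
        ... | inj₂ (inj₂ (B₁ , refl , χB₁ , B₁≢B₀ , B₁≢-B₀)) =
          ∧-true⁺ (negB-closed B₁ χB₁) (∧-true⁺ (≢⇒not-eqBlock (B₁≢-B₀ ∘ cong negB)) (≢⇒not-eqBlock (B₁≢B₀ ∘ cong negB)))

        zero-unique′ : ∀ B B′ → χ′ B ≡ true → χ′ B′ ≡ true → negB B ≡ B → negB B′ ≡ B′ → B ≡ B′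
        zero-unique′ B B′ h h′ z z′ with extend-true⁻ b B₀ B h | extend-true⁻ b B₀ B′ h′
        ... | inj₁ refl | inj₁ refl = refl
        ... | inj₁ refl | inj₂ (inj₁ (refl , refl)) = ⊥-elim (false≢true (cong (Vec.head ∘ proj₁) z))
        ... | inj₁ refl | inj₂ (inj₂ (B₁ , refl , χB₁ , B₁≢B₀ , _)) = ⊥-elim (new-zero-old-zero b B₀ v z B₁ χB₁ B₁≢B₀ (cong tailB z′))
        ... | inj₂ (inj₁ (refl , refl)) | inj₁ refl = ⊥-elim (false≢true (cong (Vec.head ∘ proj₁) z′))
        ... | inj₂ (inj₁ (refl , refl)) | inj₂ (inj₁ (refl , refl)) = refl
        ... | inj₂ (inj₁ (refl , refl)) | inj₂ (inj₂ (B₁ , refl , _)) = ⊥-elim (true≢false (cong (Vec.head ∘ proj₁) z))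
        ... | inj₂ (inj₂ (B₁ , refl , χB₁ , B₁≢B₀ , _)) | inj₁ refl = ⊥-elim (new-zero-old-zero b B₀ v z′ B₁ χB₁ B₁≢B₀ (cong tailB z))
        ... | inj₂ (inj₂ (B₁ , refl , _)) | inj₂ (inj₁ (refl , refl)) = ⊥-elim (true≢false (cong (Vec.head ∘ proj₁) z′))
        ... | inj₂ (inj₂ (B₁ , refl , χB₁ , _)) | inj₂ (inj₂ (B₂ , refl , χB₂ , _)) =
          cong liftB (zero-unique B₁ B₂ χB₁ χB₂ (cong tailB z) (cong tailB z′))

  module _ {m : ℕ} where

    extend-injective : ∀ {χ χ′ : Block m → Bool} → IsTypeBPartition χ → IsTypeBPartition χ′ →
                       ∀ b B₀ b′ B₀′ → ValidChoice χ (b , B₀) → ValidChoice χ′ (b′ , B₀′) →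
                       (∀ B → extend χ (b , B₀) B ≡ extend χ′ (b′ , B₀′) B) → (b , B₀) ≡ (b′ , B₀′) × (∀ B → χ B ≡ χ′ B)
    extend-injective {χ} {χ′} P P′ b B₀ b′ B₀′ v v′ ext≡ with same-choice b (trans (sym (ext≡ (addOne b B₀))) (extend-addOne b B₀))
      where
      same-choice : ∀ b → extend χ′ (b′ , B₀′) (addOne b B₀) ≡ true → (b , B₀) ≡ (b′ , B₀′)
      same-choice true  h with ∧-true⁻ {b′} h
      ... | refl , eq = cong (true ,_) (eqBlock⇒≡ eq)
      same-choice false h with ∧-true⁻ {not b′} h
      ... | nb′ , eq with not-true⁻ {b′} nb′
      ... | refl = cong (false ,_) (eqBlock⇒≡ eq)
    ... | refl = refl , same-blocks
      where
      same-blocks : ∀ B₁ → χ B₁ ≡ χ′ B₁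
      same-blocks B₁ with eqBlock B₁ B₀ in B₁==B₀
      ... | true = subst (λ X → χ X ≡ χ′ X) (sym (eqBlock⇒≡ B₁==B₀))
                     (trans (valid-member≡nonempty P b B₀ v) (sym (valid-member≡nonempty P′ b B₀ v′)))
      ... | false with eqBlock B₁ (negB B₀) in B₁==-B₀
      ...   | true = subst (λ X → χ X ≡ χ′ X) (sym (eqBlock⇒≡ B₁==-B₀))
                       (trans (valid-member≡nonempty-negB P b B₀ v) (sym (valid-member≡nonempty-negB P′ b B₀ v′)))
      ...   | false = trans (sym (∧-identityʳ (χ B₁)))
                        (trans (subst (λ X → χ B₁ ∧ X ≡ χ′ B₁ ∧ X) (cong₂ (λ x y → not x ∧ not y) B₁==B₀ B₁==-B₀) (ext≡ (liftB B₁)))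
                               (∧-identityʳ (χ′ B₁)))

  -- Deletes ±1 from a type B partition of [m+1] whose block containing +1 is addOne b B₀; the
  -- blocks B₀ and -B₀ survive only if they are nonempty.
  module Restriction {m : ℕ} {χ : Block (suc m) → Bool} (P : IsTypeBPartition χ) (b : Bool) (B₀ : Block m)
                     (χ-new : χ (addOne b B₀) ≡ true) where
    open IsTypeBPartition P

    new : Block (suc m)
    new = addOne b B₀

    restricted : Block m → Bool
    restricted B = χ (liftB B) ∨ (nonemptyB B ∧ (eqBlock B B₀ ∨ eqBlock B (negB B₀)))

    χ-negB-new : χ (negB new) ≡ true
    χ-negB-new = negB-closed new χ-new

    new-unique : ∀ B → χ B ≡ true → contains true zero B ≡ true → B ≡ new
    new-unique B χB B₀ = disjoint B new true zero χB χ-new B₀ refl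

    liftB-nonempty : ∀ B₁ → χ (liftB B₁) ≡ true → ∃₂ λ s j → contains s j B₁ ≡ true
    liftB-nonempty B₁ χB₁ with nonemptyB⇒∃ (liftB B₁) (nonempty (liftB B₁) χB₁)
    ... | s , zero  , e = ⊥-elim (false≢true (trans (sym (contains-liftB-zero s B₁)) e))
    ... | s , suc j , e = s , j , trans (sym (contains-consB s j false false B₁)) e

    liftB-disjoint-B₀ : ∀ B₁ s j → χ (liftB B₁) ≡ true → contains s j B₁ ≡ true → contains s j B₀ ≡ true → ⊥
    liftB-disjoint-B₀ B₁ s j χB₁ B₁ⱼ B₀ⱼ = false≢true (cong (Vec.head ∘ proj₁)
      (disjoint (liftB B₁) new s (suc j) χB₁ χ-new (trans (contains-consB s j false false B₁) B₁ⱼ) (trans (contains-consB s j true b B₀) B₀ⱼ)))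

    liftB-disjoint-negB-B₀ : ∀ B₁ s j → χ (liftB B₁) ≡ true → contains s j B₁ ≡ true → contains s j (negB B₀) ≡ true → ⊥
    liftB-disjoint-negB-B₀ B₁ s j χB₁ B₁ⱼ -B₀ⱼ = false≢true (cong (Vec.head ∘ proj₂)
      (disjoint (liftB B₁) (negB new) s (suc j) χB₁ χ-negB-new
                (trans (contains-consB s j false false B₁) B₁ⱼ) (trans (contains-consB s j b true (negB B₀)) -B₀ⱼ)))

    not-liftB-B₀ : χ (liftB B₀) ≡ true → ⊥
    not-liftB-B₀ χB₀ = let s , j , e = liftB-nonempty B₀ χB₀ in liftB-disjoint-B₀ B₀ s j χB₀ e e

    not-liftB-negB-B₀ : χ (liftB (negB B₀)) ≡ true → ⊥
    not-liftB-negB-B₀ χ-B₀ = let s , j , e = liftB-nonempty (negB B₀) χ-B₀ in liftB-disjoint-negB-B₀ (negB B₀) s j χ-B₀ e e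

    new≡negB-new : ∀ s j → contains s j B₀ ≡ true → contains s j (negB B₀) ≡ true → new ≡ negB new
    new≡negB-new s j B₀ⱼ -B₀ⱼ =
      disjoint new (negB new) s (suc j) χ-new χ-negB-new (trans (contains-consB s j true b B₀) B₀ⱼ) (trans (contains-consB s j b true (negB B₀)) -B₀ⱼ)

    new-zero : negB B₀ ≡ B₀ → nonemptyB B₀ ≡ true → negB new ≡ new
    new-zero zB₀ ne = let s , j , B₀ⱼ = nonemptyB⇒∃ B₀ ne in sym (new≡negB-new s j B₀ⱼ (subst (λ X → contains s j X ≡ true) (sym zB₀) B₀ⱼ))

    restricted-B₀ : nonemptyB B₀ ≡ true → restricted B₀ ≡ true
    restricted-B₀ ne = ∨-true⁺ʳ (∧-true⁺ ne (∨-true⁺ˡ (eqBlock-refl B₀)))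

    restricted-negB-B₀ : nonemptyB (negB B₀) ≡ true → restricted (negB B₀) ≡ true
    restricted-negB-B₀ ne = ∨-true⁺ʳ (∧-true⁺ ne (∨-true⁺ʳ (eqBlock-refl (negB B₀))))

    restricted-true⁻ : ∀ B → restricted B ≡ true → χ (liftB B) ≡ true ⊎ (nonemptyB B ≡ true × (B ≡ B₀ ⊎ B ≡ negB B₀))
    restricted-true⁻ B h with ∨-true⁻ {χ (liftB B)} h
    ... | inj₁ χB = inj₁ χB
    ... | inj₂ rest with ∧-true⁻ {nonemptyB B} rest
    ...   | ne , eq with ∨-true⁻ {eqBlock B B₀} eq
    ...     | inj₁ B==B₀  = inj₂ (ne , inj₁ (eqBlock⇒≡ B==B₀))
    ...     | inj₂ B==-B₀ = inj₂ (ne , inj₂ (eqBlock⇒≡ B==-B₀))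

    ±B₀-zero : ∀ B → nonemptyB B ≡ true → (B ≡ B₀ ⊎ B ≡ negB B₀) → negB B ≡ B → negB B₀ ≡ B₀ × nonemptyB B₀ ≡ true × B ≡ B₀
    ±B₀-zero B ne (inj₁ refl) z = z , ne , refl
    ±B₀-zero B ne (inj₂ refl) z = sym z , nonemptyB-negB B ne , sym z

    χ≡extend : ∀ B → χ B ≡ extend restricted (b , B₀) B
    χ≡extend (true ∷ P , true ∷ N) = ≡-from-true⇔true to from
      where
      to : χ (true ∷ P , true ∷ N) ≡ true → b ∧ eqBlock (P , N) B₀ ≡ true
      to h = let eq = new-unique _ h refl
             in ∧-true⁺ (sym (cong (Vec.head ∘ proj₂) eq)) (subst (λ X → eqBlock X B₀ ≡ true) (sym (cong tailB eq)) (eqBlock-refl B₀))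
      from : b ∧ eqBlock (P , N) B₀ ≡ true → χ (true ∷ P , true ∷ N) ≡ true
      from h with ∧-true⁻ {b} h
      ... | b≡true , eq with eqBlock⇒≡ {B = P , N} {B₀} eq
      ... | refl = subst (λ X → χ (true ∷ P , X ∷ N) ≡ true) b≡true χ-new
    χ≡extend (true ∷ P , false ∷ N) = ≡-from-true⇔true to from
      where
      to : χ (true ∷ P , false ∷ N) ≡ true → not b ∧ eqBlock (P , N) B₀ ≡ true
      to h = let eq = new-unique _ h refl
             in ∧-true⁺ (cong not (sym (cong (Vec.head ∘ proj₂) eq))) (subst (λ X → eqBlock X B₀ ≡ true) (sym (cong tailB eq)) (eqBlock-refl B₀))
      from : not b ∧ eqBlock (P , N) B₀ ≡ true → χ (true ∷ P , false ∷ N) ≡ true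
      from h with ∧-true⁻ {not b} h
      ... | nb , eq with eqBlock⇒≡ {B = P , N} {B₀} eq
      ... | refl = subst (λ X → χ (true ∷ P , X ∷ N) ≡ true) (not-true⁻ nb) χ-new
    χ≡extend (false ∷ P , true ∷ N) = ≡-from-true⇔true to from
      where
      to : χ (false ∷ P , true ∷ N) ≡ true → not b ∧ eqBlock (P , N) (negB B₀) ≡ true
      to h = let eq = new-unique _ (negB-closed _ h) refl
             in ∧-true⁺ (cong not (sym (cong (Vec.head ∘ proj₂) eq)))
                        (subst (λ X → eqBlock X (negB B₀) ≡ true) (sym (cong (negB ∘ tailB) eq)) (eqBlock-refl (negB B₀)))
      from : not b ∧ eqBlock (P , N) (negB B₀) ≡ true → χ (false ∷ P , true ∷ N) ≡ true
      from h with ∧-true⁻ {not b} h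
      ... | nb , eq with eqBlock⇒≡ {B = P , N} {negB B₀} eq
      ... | refl = subst (λ X → χ (X ∷ P , true ∷ N) ≡ true) (not-true⁻ nb) χ-negB-new
    χ≡extend (false ∷ P , false ∷ N) = ≡-from-true⇔true to from
      where
      B₁ : Block m
      B₁ = P , N
      to : χ (liftB B₁) ≡ true → restricted B₁ ∧ (not (eqBlock B₁ B₀) ∧ not (eqBlock B₁ (negB B₀))) ≡ true
      to h = ∧-true⁺ (∨-true⁺ˡ h) (∧-true⁺ (≢⇒not-eqBlock (λ eq → not-liftB-B₀ (subst (λ X → χ (liftB X) ≡ true) eq h)))
                                          (≢⇒not-eqBlock (λ eq → not-liftB-negB-B₀ (subst (λ X → χ (liftB X) ≡ true) eq h))))
      from : restricted B₁ ∧ (not (eqBlock B₁ B₀) ∧ not (eqBlock B₁ (negB B₀))) ≡ true → χ (liftB B₁) ≡ true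
      from h with ∧-true⁻ {restricted B₁} h
      ... | rB₁ , rest with ∧-true⁻ {not (eqBlock B₁ B₀)} rest | restricted-true⁻ B₁ rB₁
      ...   | _      , _       | inj₁ χB₁               = χB₁
      ...   | B₁≢B₀  , _       | inj₂ (_ , inj₁ B₁≡B₀)  = ⊥-elim (not-eqBlock⇒≢ B₁≢B₀ B₁≡B₀)
      ...   | _      , B₁≢-B₀  | inj₂ (_ , inj₂ B₁≡-B₀) = ⊥-elim (not-eqBlock⇒≢ B₁≢-B₀ B₁≡-B₀)

    private
      old-zero-±B₀-zero : ∀ B₁ B₂ → χ (liftB B₁) ≡ true → negB B₁ ≡ B₁ →
                          nonemptyB B₂ ≡ true → (B₂ ≡ B₀ ⊎ B₂ ≡ negB B₀) → negB B₂ ≡ B₂ → ⊥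
      old-zero-±B₀-zero B₁ B₂ χB₁ zB₁ ne B₂≡±B₀ zB₂ =
        let zB₀ , neB₀ , _ = ±B₀-zero B₂ ne B₂≡±B₀ zB₂
        in false≢true (cong (Vec.head ∘ proj₁) (zero-unique (liftB B₁) new χB₁ χ-new (cong liftB zB₁) (new-zero zB₀ neB₀)))

    restricted-isTypeB : IsTypeBPartition restricted
    restricted-isTypeB = record
      { nonempty = nonempty′ ; disjoint = disjoint′ ; covering = covering′ ; negB-closed = negB-closed′ ; zero-unique = zero-unique′ }
      where
      nonempty′ : ∀ B → restricted B ≡ true → nonemptyB B ≡ true
      nonempty′ B h with restricted-true⁻ B h
      ... | inj₁ χB     = let s , j , e = liftB-nonempty B χB in ∃⇒nonemptyB B s j e
      ... | inj₂ (ne , _) = ne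

      disjoint′ : ∀ B₁ B₂ s i → restricted B₁ ≡ true → restricted B₂ ≡ true →
                  contains s i B₁ ≡ true → contains s i B₂ ≡ true → B₁ ≡ B₂
      disjoint′ B₁ B₂ s i h₁ h₂ e₁ e₂ with restricted-true⁻ B₁ h₁ | restricted-true⁻ B₂ h₂
      ... | inj₁ χB₁ | inj₁ χB₂ = cong tailB (disjoint (liftB B₁) (liftB B₂) s (suc i) χB₁ χB₂
                                    (trans (contains-consB s i false false B₁) e₁) (trans (contains-consB s i false false B₂) e₂))
      ... | inj₁ χB₁ | inj₂ (_ , inj₁ refl) = ⊥-elim (liftB-disjoint-B₀ B₁ s i χB₁ e₁ e₂)
      ... | inj₁ χB₁ | inj₂ (_ , inj₂ refl) = ⊥-elim (liftB-disjoint-negB-B₀ B₁ s i χB₁ e₁ e₂)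
      ... | inj₂ (_ , inj₁ refl) | inj₁ χB₂ = ⊥-elim (liftB-disjoint-B₀ B₂ s i χB₂ e₂ e₁)
      ... | inj₂ (_ , inj₂ refl) | inj₁ χB₂ = ⊥-elim (liftB-disjoint-negB-B₀ B₂ s i χB₂ e₂ e₁)
      ... | inj₂ (_ , inj₁ refl) | inj₂ (_ , inj₁ refl) = refl
      ... | inj₂ (_ , inj₂ refl) | inj₂ (_ , inj₂ refl) = refl
      ... | inj₂ (_ , inj₁ refl) | inj₂ (_ , inj₂ refl) = cong tailB (new≡negB-new s i e₁ e₂)
      ... | inj₂ (_ , inj₂ refl) | inj₂ (_ , inj₁ refl) = sym (cong tailB (new≡negB-new s i e₂ e₁))

      covering-via : ∀ s i (B : Block (suc m)) → χ B ≡ true → contains s (suc i) B ≡ true →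
                     ∃ λ B₁ → restricted B₁ ≡ true × contains s i B₁ ≡ true
      covering-via s i (true ∷ P , q ∷ N) χB e =
        let B₀ᵢ = subst (λ X → contains s i X ≡ true) (cong tailB (new-unique _ χB refl)) (trans (sym (contains-consB s i true q (P , N))) e)
        in B₀ , restricted-B₀ (∃⇒nonemptyB B₀ s i B₀ᵢ) , B₀ᵢ
      covering-via s i (false ∷ P , true ∷ N) χB e =
        let -B₀ᵢ = subst (λ X → contains s i X ≡ true) (cong (negB ∘ tailB) (new-unique _ (negB-closed _ χB) refl))
                         (trans (sym (contains-consB s i false true (P , N))) e)
        in negB B₀ , restricted-negB-B₀ (∃⇒nonemptyB (negB B₀) s i -B₀ᵢ) , -B₀ᵢ
      covering-via s i (false ∷ P , false ∷ N) χB e = (P , N) , ∨-true⁺ˡ χB , trans (sym (contains-consB s i false false (P , N))) e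

      covering′ : ∀ s i → ∃ λ B₁ → restricted B₁ ≡ true × contains s i B₁ ≡ true
      covering′ s i = let B , χB , Bᵢ = covering s (suc i) in covering-via s i B χB Bᵢ

      negB-closed′ : ∀ B → restricted B ≡ true → restricted (negB B) ≡ true
      negB-closed′ B h with restricted-true⁻ B h
      ... | inj₁ χB = ∨-true⁺ˡ (negB-closed (liftB B) χB)
      ... | inj₂ (ne , inj₁ refl) = restricted-negB-B₀ (nonemptyB-negB B₀ ne)
      ... | inj₂ (ne , inj₂ refl) = restricted-B₀ (nonemptyB-negB (negB B₀) ne)

      zero-unique′ : ∀ B₁ B₂ → restricted B₁ ≡ true → restricted B₂ ≡ true → negB B₁ ≡ B₁ → negB B₂ ≡ B₂ → B₁ ≡ B₂
      zero-unique′ B₁ B₂ h₁ h₂ z₁ z₂ with restricted-true⁻ B₁ h₁ | restricted-true⁻ B₂ h₂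
      ... | inj₁ χB₁ | inj₁ χB₂ = cong tailB (zero-unique (liftB B₁) (liftB B₂) χB₁ χB₂ (cong liftB z₁) (cong liftB z₂))
      ... | inj₁ χB₁ | inj₂ (ne , B₂≡±B₀) = ⊥-elim (old-zero-±B₀-zero B₁ B₂ χB₁ z₁ ne B₂≡±B₀ z₂)
      ... | inj₂ (ne , B₁≡±B₀) | inj₁ χB₂ = ⊥-elim (old-zero-±B₀-zero B₂ B₁ χB₂ z₂ ne B₁≡±B₀ z₁)
      ... | inj₂ (ne₁ , B₁≡±B₀) | inj₂ (ne₂ , B₂≡±B₀) =
        trans (proj₂ (proj₂ (±B₀-zero B₁ ne₁ B₁≡±B₀ z₁))) (sym (proj₂ (proj₂ (±B₀-zero B₂ ne₂ B₂≡±B₀ z₂))))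

  module _ {m : ℕ} {χ : Block (suc m) → Bool} (P : IsTypeBPartition χ) where
    open IsTypeBPartition P

    restriction-valid : ∀ b B₀ (χ-new : χ (addOne b B₀) ≡ true) → ValidChoice (Restriction.restricted P b B₀ χ-new) (b , B₀)
    restriction-valid true B₀ χ-new = cong tailB negB-new≡new , B₀-or-none
      where
      open Restriction P true B₀ χ-new
      negB-new≡new : negB new ≡ new
      negB-new≡new = new-unique (negB new) χ-negB-new refl
      B₀-or-none : restricted B₀ ≡ true ⊎ (B₀ ≡ ∅ᴮ × (∀ B → restricted B ≡ true → negB B ≢ B))
      B₀-or-none with true⊎false (nonemptyB B₀)
      ... | inj₁ ne = inj₁ (restricted-B₀ ne)
      ... | inj₂ ne = inj₂ (nonemptyB-false⁻ B₀ ne , no-other-zero)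
        where
        no-other-zero : ∀ B → restricted B ≡ true → negB B ≢ B
        no-other-zero B h z with restricted-true⁻ B h
        ... | inj₁ χB = false≢true (cong (Vec.head ∘ proj₁) (zero-unique (liftB B) new χB χ-new (cong liftB z) negB-new≡new))
        ... | inj₂ (ne′ , B≡±B₀) = false≢true (trans (sym ne) (proj₁ (proj₂ (±B₀-zero B ne′ B≡±B₀ z))))
    restriction-valid false B₀ χ-new with true⊎false (nonemptyB B₀)
    ... | inj₂ ne = inj₁ (nonemptyB-false⁻ B₀ ne)
    ... | inj₁ ne = inj₂ (restricted-B₀ ne , λ zB₀ → false≢true (cong (Vec.head ∘ proj₁) (new-zero zB₀ ne)))
      where open Restriction P false B₀ χ-new

    extend-surjective : ∃ λ (χ′ : Block m → Bool) → ∃ λ c → IsTypeBPartition χ′ × ValidChoice χ′ c × (∀ B → χ B ≡ extend χ′ c B)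
    extend-surjective with covering true zero
    ... | (true ∷ P₀ , b ∷ N₀) , χ-new , refl =
      restricted , (b , B₀) , restricted-isTypeB , restriction-valid b B₀ χ-new , χ≡extend
      where
      B₀ = P₀ , N₀
      open Restriction P b B₀ χ-new

  module _ {m : ℕ} where

    zeroBlock : List (Block m) → Block m
    zeroBlock []      = ∅ᴮ
    zeroBlock (B ∷ F) = if isZeroBlock B then B else zeroBlock F

    zeroBlock-spec : ∀ F → (zeroBlock F ∈ F × isZeroBlock (zeroBlock F) ≡ true)
                         ⊎ (zeroBlock F ≡ ∅ᴮ × (∀ {B} → B ∈ F → isZeroBlock B ≡ false))
    zeroBlock-spec []      = inj₂ (refl , λ ())
    zeroBlock-spec (B ∷ F) with isZeroBlock B in zB
    ... | true  = inj₁ (here refl , zB)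
    ... | false with zeroBlock-spec F
    ...   | inj₁ (z∈ , z) = inj₁ (there z∈ , z)
    ...   | inj₂ (z≡∅ , none) = inj₂ (z≡∅ , λ { (here refl) → zB ; (there B′∈) → none B′∈ })

    nonzeroBlocks : List (Block m) → List (Block m)
    nonzeroBlocks = filter (λ B → isZeroBlock B Bool.≟ false)

    choices : List (Block m) → List (Bool × Block m)
    choices F = (true , zeroBlock F) ∷ (false , ∅ᴮ) ∷ map (false ,_) (nonzeroBlocks F)

    extendList : List (Block m) → Bool × Block m → List (Block (suc m))
    extendList F c = blocks (extend (indicator F) c)

    ∈-nonzeroBlocks⁻ : ∀ {F B} → B ∈ nonzeroBlocks F → B ∈ F × isZeroBlock B ≡ false
    ∈-nonzeroBlocks⁻ {F} = ∈-filter⁻ (λ B → isZeroBlock B Bool.≟ false) {xs = F}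

    isZeroBlock-false⇒ : ∀ (B : Block m) → isZeroBlock B ≡ false → negB B ≢ B
    isZeroBlock-false⇒ B nz z = true≢false (trans (sym (isZeroBlock⇐ B z)) nz)

    choice-valid : ∀ {F} → F ∈ typeBPartitions m → ∀ {c} → c ∈ choices F → ValidChoice (indicator F) c
    choice-valid {F} F∈ (here refl) with zeroBlock-spec F
    ... | inj₁ (z∈ , z) = isZeroBlock⇒ _ z , inj₁ (∈⇒any== z∈)
    ... | inj₂ (z≡∅ , none) rewrite z≡∅ =
      refl , inj₂ (refl , λ B χB z → isZeroBlock-false⇒ B (none (any==⇒∈ {x = B} F χB)) z)
    choice-valid F∈ (there (here refl)) = inj₁ refl
    choice-valid {F} F∈ (there (there c∈)) with ∈-map⁻ (false ,_) c∈
    ... | B₀ , B₀∈ , refl = let B₀∈F , nz = ∈-nonzeroBlocks⁻ {F} B₀∈ in inj₂ (∈⇒any== B₀∈F , isZeroBlock-false⇒ B₀ nz)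

    valid-choice : ∀ {F} → F ∈ typeBPartitions m → ∀ c → ValidChoice (indicator F) c → c ∈ choices F
    valid-choice {F} F∈ (true , B₀) (z , inj₁ χB₀) with zeroBlock-spec F
    ... | inj₁ (z∈ , zz) = here (cong (true ,_) (zero-unique B₀ (zeroBlock F) χB₀ (∈⇒any== z∈) z (isZeroBlock⇒ _ zz)))
      where open IsTypeBPartition (typeBPartition-isTypeB F∈)
    ... | inj₂ (_ , none) = ⊥-elim (true≢false (trans (sym (isZeroBlock⇐ B₀ z)) (none (any==⇒∈ {x = B₀} F χB₀))))
    valid-choice {F} F∈ (true , B₀) (z , inj₂ (refl , no-zero)) with zeroBlock-spec F
    ... | inj₁ (z∈ , zz) = ⊥-elim (no-zero (zeroBlock F) (∈⇒any== z∈) (isZeroBlock⇒ _ zz))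
    ... | inj₂ (z≡∅ , _) = here (cong (true ,_) (sym z≡∅))
    valid-choice F∈ (false , B₀) (inj₁ refl) = there (here refl)
    valid-choice {F} F∈ (false , B₀) (inj₂ (χB₀ , nonzero)) =
      there (there (∈-map⁺ (false ,_) (∈-filter⁺ (λ B → isZeroBlock B Bool.≟ false) {xs = F} (any==⇒∈ {x = B₀} F χB₀) nzB₀)))
      where
      nzB₀ : isZeroBlock B₀ ≡ false
      nzB₀ with true⊎false (isZeroBlock B₀)
      ... | inj₁ zB₀ = ⊥-elim (nonzero (isZeroBlock⇒ B₀ zB₀))
      ... | inj₂ nzB₀ = nzB₀

    choices-unique : ∀ {F} → F ∈ typeBPartitions m → Unique (choices F)
    choices-unique {F} F∈ =
      All.tabulate zero-first ∷ All.tabulate new-second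
        ∷ Unique.map⁺ (cong proj₂) (Unique.filter⁺ (λ B → isZeroBlock B Bool.≟ false) (typeBPartition-unique F∈))
      where
      zero-first : ∀ {c} → c ∈ (false , ∅ᴮ) ∷ map (false ,_) (nonzeroBlocks F) → (true , zeroBlock F) ≢ c
      zero-first (here refl) ()
      zero-first (there c∈) eq with ∈-map⁻ (false ,_) c∈
      ... | _ , _ , refl = true≢false (cong proj₁ eq)
      new-second : ∀ {c} → c ∈ map (false ,_) (nonzeroBlocks F) → (false , ∅ᴮ) ≢ c
      new-second c∈ eq with ∈-map⁻ (false ,_) c∈
      ... | B , B∈ , refl = true≢false (trans (sym (IsTypeBPartition.nonempty (typeBPartition-isTypeB F∈) B (∈⇒any== (proj₁ (∈-nonzeroBlocks⁻ {F} B∈)))))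
                                              (subst (λ X → nonemptyB X ≡ false) (cong proj₂ eq) (nonemptyB-∅ᴮ {m})))

    extendList-injective : ∀ {F F′} → F ∈ typeBPartitions m → F′ ∈ typeBPartitions m → ∀ {c c′} → c ∈ choices F → c′ ∈ choices F′ →
                           extendList F c ≡ extendList F′ c′ → F ≡ F′ × c ≡ c′
    extendList-injective {F} {F′} F∈ F′∈ {b , B₀} {b′ , B₀′} c∈ c′∈ eq
      with extend-injective (typeBPartition-isTypeB F∈) (typeBPartition-isTypeB F′∈) b B₀ b′ B₀′ (choice-valid F∈ c∈) (choice-valid F′∈ c′∈)
             (λ B → trans (sym (indicator-blocks _ B)) (trans (cong (λ G → indicator G B) eq) (indicator-blocks _ B)))
    ... | c≡c′ , χ≡χ′ =
      trans (typeBPartition≡blocks F∈) (trans (filterᵇ-cong (allBlocks m) (λ {B} _ → χ≡χ′ B)) (sym (typeBPartition≡blocks F′∈))) , c≡c′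

    extensions : List (List (Block (suc m)))
    extensions = concatMap (λ F → map (extendList F) (choices F)) (typeBPartitions m)

    ∈-extensions⁻ : ∀ {F′} → F′ ∈ extensions → ∃₂ λ F c → F ∈ typeBPartitions m × c ∈ choices F × F′ ≡ extendList F c
    ∈-extensions⁻ F′∈ with find (∈-concatMap⁻ (λ F → map (extendList F) (choices F)) {xs = typeBPartitions m} F′∈)
    ... | F , F∈ , F′∈F with ∈-map⁻ (extendList F) F′∈F
    ... | c , c∈ , refl = F , c , F∈ , c∈ , refl

    extensions-unique : Unique extensions
    extensions-unique = concatMap-unique _ typeBPartitions-unique
      (λ {F} F∈ → map-unique (extendList F) (choices-unique F∈) (λ c∈ c′∈ eq → proj₂ (extendList-injective F∈ F∈ c∈ c′∈ eq)))
      (λ {F} {F′} F∈ F′∈ G∈ G∈′ →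
        let c , c∈ , G≡ = ∈-map⁻ (extendList F) G∈ ; c′ , c′∈ , G≡′ = ∈-map⁻ (extendList F′) G∈′
        in proj₁ (extendList-injective F∈ F′∈ c∈ c′∈ (trans (sym G≡) G≡′)))

    extensions⊆ : ∀ {F′} → F′ ∈ extensions → F′ ∈ typeBPartitions (suc m)
    extensions⊆ F′∈ with ∈-extensions⁻ F′∈
    ... | F , (b , B₀) , F∈ , c∈ , refl =
      blocks∈typeBPartitions (extend-isTypeB (typeBPartition-isTypeB F∈) b B₀ (choice-valid F∈ c∈))

    ⊆extensions : ∀ {F′} → F′ ∈ typeBPartitions (suc m) → F′ ∈ extensions
    ⊆extensions {F′} F′∈ with extend-surjective (typeBPartition-isTypeB F′∈)
    ... | χ , c , P , v , χ′≡extend =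
      subst (_∈ extensions) (sym F′≡) (∈-concatMap⁺ _ (lose F∈ (∈-map⁺ (extendList F) c∈)))
      where
      F = blocks χ
      F∈ = blocks∈typeBPartitions P
      χ≡ : ∀ B → χ B ≡ indicator F B
      χ≡ B = sym (indicator-blocks χ B)
      c∈ = valid-choice F∈ c (ValidChoice-cong χ≡ c v)
      F′≡ : F′ ≡ extendList F c
      F′≡ = trans (typeBPartition≡blocks F′∈) (filterᵇ-cong (allBlocks (suc m)) (λ {B} _ → trans (χ′≡extend B) (extend-cong χ≡ c B)))

    typeBPartitions-suc↭ : typeBPartitions (suc m) ↭ extensions
    typeBPartitions-suc↭ = ∼bag⇒↭ (unique∧set⇒bag typeBPartitions-unique extensions-unique (mk⇔ ⊆extensions extensions⊆))

  -- Counting representative non-zero blocks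

  allBoolPairs : List (Bool × Bool)
  allBoolPairs = (true , true) ∷ (true , false) ∷ (false , true) ∷ (false , false) ∷ []

  allBlocks-suc↭ : ∀ m → allBlocks (suc m) ↭ concatMap (λ (p , q) → map (consB p q) (allBlocks m)) allBoolPairs
  allBlocks-suc↭ m = ∼bag⇒↭ (unique∧set⇒bag (allBlocks-unique (suc m)) unique (mk⇔ complete (λ _ → allBlocks-complete _)))
    where
    layer : Bool × Bool → List (Block (suc m))
    layer (p , q) = map (consB p q) (allBlocks m)
    complete : ∀ {B} → B ∈ allBlocks (suc m) → B ∈ concatMap layer allBoolPairs
    complete {p ∷ P , q ∷ N} _ = ∈-concatMap⁺ layer (lose (pair∈ p q) (∈-map⁺ (consB p q) (allBlocks-complete (P , N))))
      where
      pair∈ : ∀ p q → (p , q) ∈ allBoolPairs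
      pair∈ true  true  = here refl
      pair∈ true  false = there (here refl)
      pair∈ false true  = there (there (here refl))
      pair∈ false false = there (there (there (here refl)))
    pairs-unique : Unique allBoolPairs
    pairs-unique = ((λ ()) ∷ (λ ()) ∷ (λ ()) ∷ []) ∷ ((λ ()) ∷ (λ ()) ∷ []) ∷ ((λ ()) ∷ []) ∷ [] ∷ []
    unique : Unique (concatMap layer allBoolPairs)
    unique = concatMap-unique layer pairs-unique (λ _ → map-unique _ (allBlocks-unique m) (λ _ _ → cong tailB))
      λ {pq} {pq′} _ _ B∈ B∈′ →
        let _ , _ , B≡ = ∈-map⁻ (consB (proj₁ pq) (proj₂ pq)) B∈ ; _ , _ , B≡′ = ∈-map⁻ (consB (proj₁ pq′) (proj₂ pq′)) B∈′
            eq = trans (sym B≡) B≡′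
        in cong₂ _,_ (cong (Vec.head ∘ proj₁) eq) (cong (Vec.head ∘ proj₂) eq)

  count-allBlocks-suc : ∀ {m} (f : Block (suc m) → Bool) → count f (allBlocks (suc m)) ≡
    count (f ∘ consB true true) (allBlocks m) + (count (f ∘ consB true false) (allBlocks m)
      + (count (f ∘ consB false true) (allBlocks m) + (count (f ∘ consB false false) (allBlocks m) + 0)))
  count-allBlocks-suc {m} f =
    trans (count-↭ f (allBlocks-suc↭ m))
      (trans (count-concatMap f (λ (p , q) → map (consB p q) (allBlocks m)) allBoolPairs)
             (cong sum (Listₚ.map-cong (λ (p , q) → count-map f (consB p q) (allBlocks m)) allBoolPairs)))

  nonzeroCount : ∀ {n} → List (Block n) → ℕ
  nonzeroCount F = length (filter (λ B → isZeroBlock B Bool.≟ false) F)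

  isZeroBlock-negB : ∀ {n} (B : Block n) → isZeroBlock (negB B) ≡ isZeroBlock B
  isZeroBlock-negB (P , N) = ∧-comm (eqVec P N) (eqVec N P)

  ∧-rearrange : ∀ x a b z → (x ∧ (a ∧ b)) ∧ z ≡ ((x ∧ z) ∧ a) ∧ b
  ∧-rearrange false a b z     = refl
  ∧-rearrange true  a b true  = ∧-identityʳ (a ∧ b)
  ∧-rearrange true  a b false = ∧-zeroʳ (a ∧ b)

  module _ {n : ℕ} where

    nonzero : (Block n → Bool) → Block n → Bool
    nonzero χ B = χ B ∧ not (isZeroBlock B)

    nonzeroCount-blocks : ∀ χ → nonzeroCount (blocks χ) ≡ count (nonzero χ) (allBlocks n)
    nonzeroCount-blocks χ = length-filter-filterᵇ χ isZeroBlock (allBlocks n)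

    other : (Block n → Bool) → Block n → Block n → Bool
    other χ B₀ B = χ B ∧ (not (eqBlock B B₀) ∧ not (eqBlock B (negB B₀)))

    count-allBlocks-eqBlock : ∀ B₀ → count (λ B → eqBlock B B₀ ∧ true) (allBlocks n) ≡ 1
    count-allBlocks-eqBlock B₀ =
      trans (BlockMembership.count-without _ (allBlocks n) (allBlocks-unique n) (allBlocks-complete B₀))
            (cong₂ _+_ (trans (count-cong (allBlocks n) λ {B} _ → lemma B) (count-false (allBlocks n)))
                       (cong bit (trans (∧-identityʳ (eqBlock B₀ B₀)) (eqBlock-refl B₀))))
      where
      lemma : ∀ B → (eqBlock B B₀ ∧ true) ∧ not (eqBlock B B₀) ≡ false
      lemma B with eqBlock B B₀
      ... | true  = refl
      ... | false = refl

    private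
     count-nonzero-other : ∀ χ B₀ → count (nonzero χ) (allBlocks n)
      ≡ count (nonzero (other χ B₀)) (allBlocks n) + bit (nonzero χ (negB B₀) ∧ not (eqBlock (negB B₀) B₀)) + bit (nonzero χ B₀)
     count-nonzero-other χ B₀ = begin
      count (nonzero χ) (allBlocks n)
        ≡⟨ count-without (nonzero χ) B₀ ⟩
      count (λ B → nonzero χ B ∧ not (eqBlock B B₀)) (allBlocks n) + bit (nonzero χ B₀)
        ≡⟨ cong (_+ bit (nonzero χ B₀)) (count-without (λ B → nonzero χ B ∧ not (eqBlock B B₀)) (negB B₀)) ⟩
      count (λ B → (nonzero χ B ∧ not (eqBlock B B₀)) ∧ not (eqBlock B (negB B₀))) (allBlocks n)
        + bit (nonzero χ (negB B₀) ∧ not (eqBlock (negB B₀) B₀)) + bit (nonzero χ B₀)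
        ≡⟨ cong (λ c → c + bit (nonzero χ (negB B₀) ∧ not (eqBlock (negB B₀) B₀)) + bit (nonzero χ B₀))
                (count-cong (allBlocks n) (λ {B} _ → sym (∧-rearrange (χ B) _ _ (not (isZeroBlock B))))) ⟩
      count (nonzero (other χ B₀)) (allBlocks n) + bit (nonzero χ (negB B₀) ∧ not (eqBlock (negB B₀) B₀)) + bit (nonzero χ B₀)
        ∎
      where
      open ≡-Reasoning
      count-without : ∀ f B₀ → count f (allBlocks n) ≡ count (λ B → f B ∧ not (eqBlock B B₀)) (allBlocks n) + bit (f B₀)
      count-without f B₀ = BlockMembership.count-without f (allBlocks n) (allBlocks-unique n) (allBlocks-complete B₀)


    count-nonzero-other-absent : ∀ χ B₀ → nonzero χ B₀ ≡ false → nonzero χ (negB B₀) ≡ false →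
                                 count (nonzero (other χ B₀)) (allBlocks n) ≡ count (nonzero χ) (allBlocks n)
    count-nonzero-other-absent χ B₀ B₀∉ -B₀∉ = sym (begin
      count (nonzero χ) (allBlocks n)
        ≡⟨ count-nonzero-other χ B₀ ⟩
      count (nonzero (other χ B₀)) (allBlocks n) + bit (nonzero χ (negB B₀) ∧ not (eqBlock (negB B₀) B₀)) + bit (nonzero χ B₀)
        ≡⟨ cong₂ (λ a b → count (nonzero (other χ B₀)) (allBlocks n) + bit (a ∧ not (eqBlock (negB B₀) B₀)) + bit b) -B₀∉ B₀∉ ⟩
      count (nonzero (other χ B₀)) (allBlocks n) + 0 + 0
        ≡⟨ trans (ℕₚ.+-identityʳ _) (ℕₚ.+-identityʳ _) ⟩
      count (nonzero (other χ B₀)) (allBlocks n)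
        ∎)
      where open ≡-Reasoning

    count-nonzero-other-present : ∀ χ B₀ → nonzero χ B₀ ≡ true → nonzero χ (negB B₀) ≡ true → negB B₀ ≢ B₀ →
                                  2 + count (nonzero (other χ B₀)) (allBlocks n) ≡ count (nonzero χ) (allBlocks n)
    count-nonzero-other-present χ B₀ B₀∈ -B₀∈ -B₀≢B₀ = sym (begin
      count (nonzero χ) (allBlocks n)
        ≡⟨ count-nonzero-other χ B₀ ⟩
      count (nonzero (other χ B₀)) (allBlocks n) + bit (nonzero χ (negB B₀) ∧ not (eqBlock (negB B₀) B₀)) + bit (nonzero χ B₀)
        ≡⟨ cong₂ (λ a b → count (nonzero (other χ B₀)) (allBlocks n) + bit a + bit b) (∧-true⁺ -B₀∈ (≢⇒not-eqBlock -B₀≢B₀)) B₀∈ ⟩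
      count (nonzero (other χ B₀)) (allBlocks n) + 1 + 1
        ≡⟨ ℕₚ.+-comm (count (nonzero (other χ B₀)) (allBlocks n) + 1) 1 ⟩
      1 + (count (nonzero (other χ B₀)) (allBlocks n) + 1)
        ≡⟨ cong suc (ℕₚ.+-comm _ 1) ⟩
      2 + count (nonzero (other χ B₀)) (allBlocks n)
        ∎)
      where open ≡-Reasoning

  module _ {m : ℕ} (χ : Block m → Bool) where

    count-nonzero-extend-true : ∀ B₀ → negB B₀ ≡ B₀ → count (nonzero (extend χ (true , B₀))) (allBlocks (suc m)) ≡ count (nonzero χ) (allBlocks m)
    count-nonzero-extend-true B₀ zB₀ = begin
      count (nonzero (extend χ (true , B₀))) (allBlocks (suc m))
        ≡⟨ count-allBlocks-suc (nonzero (extend χ (true , B₀))) ⟩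
      count (λ B → eqBlock B B₀ ∧ not (isZeroBlock B)) (allBlocks m) + (count (λ _ → false) (allBlocks m)
        + (count (λ _ → false) (allBlocks m) + (count (nonzero (other χ B₀)) (allBlocks m) + 0)))
        ≡⟨ cong₂ (λ a b → a + (b + (b + (count (nonzero (other χ B₀)) (allBlocks m) + 0)))) B₀-only-zero (count-false (allBlocks m)) ⟩
      count (nonzero (other χ B₀)) (allBlocks m) + 0
        ≡⟨ ℕₚ.+-identityʳ _ ⟩
      count (nonzero (other χ B₀)) (allBlocks m)
        ≡⟨ count-nonzero-other-absent χ B₀ B₀-excluded (trans (cong (nonzero χ) zB₀) B₀-excluded) ⟩
      count (nonzero χ) (allBlocks m)
        ∎
      where
      open ≡-Reasoning
      B₀-excluded : nonzero χ B₀ ≡ false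
      B₀-excluded = trans (cong (λ t → χ B₀ ∧ not t) (isZeroBlock⇐ B₀ zB₀)) (∧-zeroʳ (χ B₀))
      B₀-only-zero : count (λ B → eqBlock B B₀ ∧ not (isZeroBlock B)) (allBlocks m) ≡ 0
      B₀-only-zero = trans (count-cong (allBlocks m) (λ {B} _ → only B)) (count-false (allBlocks m))
        where
        only : ∀ B → eqBlock B B₀ ∧ not (isZeroBlock B) ≡ false
        only B with eqBlock B B₀ in B==B₀
        ... | false = refl
        ... | true  = cong not (isZeroBlock⇐ B (trans (cong negB (eqBlock⇒≡ B==B₀)) (trans zB₀ (sym (eqBlock⇒≡ B==B₀)))))

    count-nonzero-extend-false : ∀ B₀ → count (nonzero (extend χ (false , B₀))) (allBlocks (suc m)) ≡ 2 + count (nonzero (other χ B₀)) (allBlocks m)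
    count-nonzero-extend-false B₀ = begin
      count (nonzero (extend χ (false , B₀))) (allBlocks (suc m))
        ≡⟨ count-allBlocks-suc (nonzero (extend χ (false , B₀))) ⟩
      count (λ _ → false) (allBlocks m) + (count (λ B → eqBlock B B₀ ∧ true) (allBlocks m)
        + (count (λ B → eqBlock B (negB B₀) ∧ true) (allBlocks m) + (count (nonzero (other χ B₀)) (allBlocks m) + 0)))
        ≡⟨ cong₂ (λ a b → a + (b + (count (λ B → eqBlock B (negB B₀) ∧ true) (allBlocks m) + (count (nonzero (other χ B₀)) (allBlocks m) + 0))))
                 (count-false (allBlocks m)) (count-allBlocks-eqBlock B₀) ⟩
      1 + (count (λ B → eqBlock B (negB B₀) ∧ true) (allBlocks m) + (count (nonzero (other χ B₀)) (allBlocks m) + 0))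
        ≡⟨ cong (λ a → 1 + (a + (count (nonzero (other χ B₀)) (allBlocks m) + 0))) (count-allBlocks-eqBlock (negB B₀)) ⟩
      2 + (count (nonzero (other χ B₀)) (allBlocks m) + 0)
        ≡⟨ cong (2 +_) (ℕₚ.+-identityʳ _) ⟩
      2 + count (nonzero (other χ B₀)) (allBlocks m)
        ∎
      where open ≡-Reasoning

  module _ {m : ℕ} {F : List (Block m)} (F∈ : F ∈ typeBPartitions m) where
    private
      P = typeBPartition-isTypeB F∈
      χ = indicator F
    open IsTypeBPartition P

    nonzeroCount-typeB : nonzeroCount F ≡ count (nonzero χ) (allBlocks m)
    nonzeroCount-typeB = trans (cong nonzeroCount (typeBPartition≡blocks F∈)) (nonzeroCount-blocks χ)

    nonzeroCount-zero-choice : nonzeroCount (extendList F (true , zeroBlock F)) ≡ nonzeroCount F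
    nonzeroCount-zero-choice =
      trans (nonzeroCount-blocks (extend χ (true , zeroBlock F)))
            (trans (count-nonzero-extend-true χ (zeroBlock F) (proj₁ (choice-valid F∈ (here refl)))) (sym nonzeroCount-typeB))

    nonzeroCount-new-choice : nonzeroCount (extendList F (false , ∅ᴮ)) ≡ 2 + nonzeroCount F
    nonzeroCount-new-choice =
      trans (nonzeroCount-blocks (extend χ (false , ∅ᴮ)))
            (trans (count-nonzero-extend-false χ ∅ᴮ)
                   (cong (2 +_) (trans (count-nonzero-other-absent χ ∅ᴮ ∅∉ ∅∉) (sym nonzeroCount-typeB))))
      where
      ∅∉ : nonzero χ ∅ᴮ ≡ false
      ∅∉ with true⊎false (χ ∅ᴮ)
      ... | inj₁ χ∅ = ⊥-elim (true≢false (trans (sym (nonempty ∅ᴮ χ∅)) (nonemptyB-∅ᴮ {m})))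
      ... | inj₂ χ∅ = cong (_∧ _) χ∅

    nonzeroCount-pair-choice : ∀ {B₀} → B₀ ∈ nonzeroBlocks F → nonzeroCount (extendList F (false , B₀)) ≡ nonzeroCount F
    nonzeroCount-pair-choice {B₀} B₀∈ =
      trans (nonzeroCount-blocks (extend χ (false , B₀)))
            (trans (trans (count-nonzero-extend-false χ B₀) (count-nonzero-other-present χ B₀ B₀∈χ -B₀∈χ -B₀≢B₀)) (sym nonzeroCount-typeB))
      where
      B₀∈F = proj₁ (∈-nonzeroBlocks⁻ {F = F} B₀∈)
      nzB₀ = proj₂ (∈-nonzeroBlocks⁻ {F = F} B₀∈)
      -B₀≢B₀ = isZeroBlock-false⇒ B₀ nzB₀
      B₀∈χ : nonzero χ B₀ ≡ true
      B₀∈χ = ∧-true⁺ (∈⇒any== B₀∈F) (cong not nzB₀)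
      -B₀∈χ : nonzero χ (negB B₀) ≡ true
      -B₀∈χ = ∧-true⁺ (negB-closed B₀ (∈⇒any== B₀∈F)) (cong not (trans (isZeroBlock-negB B₀) nzB₀))

    nonzeroCount-choice : ∀ {c} → c ∈ choices F → nonzeroCount (extendList F c) ≡ nonzeroCount F ⊎ nonzeroCount (extendList F c) ≡ 2 + nonzeroCount F
    nonzeroCount-choice (here refl)         = inj₁ nonzeroCount-zero-choice
    nonzeroCount-choice (there (here refl)) = inj₂ nonzeroCount-new-choice
    nonzeroCount-choice (there (there c∈)) with ∈-map⁻ (false ,_) c∈
    ... | B₀ , B₀∈ , refl = inj₁ (nonzeroCount-pair-choice B₀∈)

  halves-step : ∀ {a b} → a ≡ b ⊎ a ≡ 2 + b → b ≡ ⌊ b /2⌋ + ⌊ b /2⌋ → a ≡ ⌊ a /2⌋ + ⌊ a /2⌋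
  halves-step (inj₁ refl) b-even = b-even
  halves-step {b = b} (inj₂ refl) b-even = trans (cong (2 +_) b-even) (cong suc (sym (ℕₚ.+-suc ⌊ b /2⌋ ⌊ b /2⌋)))

  nonzeroCount-even : ∀ n {F} → F ∈ typeBPartitions n → nonzeroCount F ≡ repNonZeroBlocks F + repNonZeroBlocks F
  nonzeroCount-even zero    (here refl) = refl
  nonzeroCount-even (suc m) {F} F∈ = from-extension (∈-extensions⁻ (⊆extensions F∈))
    where
    from-extension : (∃₂ λ G c → G ∈ typeBPartitions m × c ∈ choices G × F ≡ extendList G c) →
                     nonzeroCount F ≡ repNonZeroBlocks F + repNonZeroBlocks F
    from-extension (G , c , G∈ , c∈ , F≡) =
      halves-step (Sum.map (trans (cong nonzeroCount F≡)) (trans (cong nonzeroCount F≡)) (nonzeroCount-choice G∈ c∈))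
                  (nonzeroCount-even m G∈)

  occurrences : List ℕ → ℕ → ℕ
  occurrences rs k = length (filter (Nat._≟ k) rs)

  -- The numbers of representative non-zero blocks of the 2r + 2 extensions of a partition with r of them.
  spread : ℕ → List ℕ
  spread r = r ∷ suc r ∷ replicate (r + r) r

  module _ {m : ℕ} {F : List (Block m)} (F∈ : F ∈ typeBPartitions m) where

    reps-of-extensions : map (repNonZeroBlocks ∘ extendList F) (choices F) ≡ spread (repNonZeroBlocks F)
    reps-of-extensions =
      cong₂ _∷_ (cong ⌊_/2⌋ (nonzeroCount-zero-choice F∈))
        (cong₂ _∷_ (cong ⌊_/2⌋ (nonzeroCount-new-choice F∈))
          (trans (map-const-∈ _ pair-rep) (cong (λ n → replicate n (repNonZeroBlocks F)) pairs-count)))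
      where
      pairs : List (Bool × Block m)
      pairs = map (false ,_) (nonzeroBlocks F)
      pair-rep : ∀ {c} → c ∈ pairs → repNonZeroBlocks (extendList F c) ≡ repNonZeroBlocks F
      pair-rep c∈ = let B₀ , B₀∈ , c≡ = ∈-map⁻ (false ,_) c∈
                    in trans (cong (repNonZeroBlocks ∘ extendList F) c≡) (cong ⌊_/2⌋ (nonzeroCount-pair-choice F∈ B₀∈))
      pairs-count : length pairs ≡ repNonZeroBlocks F + repNonZeroBlocks F
      pairs-count = trans (Listₚ.length-map (λ (B : Block m) → (false , B)) (nonzeroBlocks F)) (nonzeroCount-even m F∈)

  occurrences-∷ : ∀ r rs k → occurrences (r ∷ rs) k ≡ bit (does (r Nat.≟ k)) + occurrences rs k
  occurrences-∷ r rs k with does (r Nat.≟ k)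
  ... | true  = refl
  ... | false = refl

  occurrences-++ : ∀ rs ss k → occurrences (rs ++ ss) k ≡ occurrences rs k + occurrences ss k
  occurrences-++ rs ss k = trans (cong length (Listₚ.filter-++ (Nat._≟ k) rs ss)) (Listₚ.length-++ (filter (Nat._≟ k) rs))

  occurrences-replicate : ∀ n r k → occurrences (replicate n r) k ≡ n * bit (does (r Nat.≟ k))
  occurrences-replicate zero    r k = refl
  occurrences-replicate (suc n) r k = trans (occurrences-∷ r (replicate n r) k) (cong (bit (does (r Nat.≟ k)) +_) (occurrences-replicate n r k))

  occurrences-↭ : ∀ {rs ss} → rs ↭ ss → ∀ k → occurrences rs k ≡ occurrences ss k
  occurrences-↭ rs↭ss k = ↭-length (filter-↭ (Nat._≟ k) rs↭ss)

  atPred-occurrences-∷ : ∀ r rs k → atPred (occurrences (r ∷ rs)) k ≡ bit (does (suc r Nat.≟ k)) + atPred (occurrences rs) k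
  atPred-occurrences-∷ r rs zero    = refl
  atPred-occurrences-∷ r rs (suc k) = occurrences-∷ r rs k

  bit-≟-weight : ∀ r k → bit (does (r Nat.≟ k)) * (2 * r + 1) ≡ bit (does (r Nat.≟ k)) * (2 * k + 1)
  bit-≟-weight r k with r Nat.≡ᵇ k in r≡ᵇk
  ... | false = refl
  ... | true rewrite ℕₚ.≡ᵇ⇒≡ r k (subst Bool.T (sym r≡ᵇk) _) = refl

  occurrences-spread : ∀ rs k → occurrences (concatMap spread rs) k ≡ (2 * k + 1) * occurrences rs k + atPred (occurrences rs) k
  occurrences-spread [] zero    = refl
  occurrences-spread [] (suc k) = sym (trans (ℕₚ.+-identityʳ ((2 * suc k + 1) * 0)) (ℕₚ.*-zeroʳ (2 * suc k + 1)))
  occurrences-spread (r ∷ rs) k = begin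
    occurrences (spread r ++ concatMap spread rs) k
      ≡⟨ occurrences-++ (spread r) (concatMap spread rs) k ⟩
    occurrences (spread r) k + occurrences (concatMap spread rs) k
      ≡⟨ cong₂ _+_ spread-r (occurrences-spread rs k) ⟩
    (b + (c + (r + r) * b)) + ((2 * k + 1) * o + p)
      ≡⟨ regroup b c r o p (2 * k + 1) ⟩
    b * (2 * r + 1) + (2 * k + 1) * o + (c + p)
      ≡⟨ cong (λ x → x + (2 * k + 1) * o + (c + p)) (bit-≟-weight r k) ⟩
    b * (2 * k + 1) + (2 * k + 1) * o + (c + p)
      ≡⟨ factor b (2 * k + 1) o (c + p) ⟩
    (2 * k + 1) * (b + o) + (c + p)
      ≡⟨ cong₂ (λ x y → (2 * k + 1) * x + y) (occurrences-∷ r rs k) (atPred-occurrences-∷ r rs k) ⟨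
    (2 * k + 1) * occurrences (r ∷ rs) k + atPred (occurrences (r ∷ rs)) k
      ∎
    where
    open ≡-Reasoning
    b = bit (does (r Nat.≟ k))
    c = bit (does (suc r Nat.≟ k))
    o = occurrences rs k
    p = atPred (occurrences rs) k
    spread-r : occurrences (spread r) k ≡ b + (c + (r + r) * b)
    spread-r = trans (occurrences-∷ r _ k) (cong (b +_) (trans (occurrences-∷ (suc r) _ k) (cong (c +_) (occurrences-replicate (r + r) r k))))
    regroup : ∀ b c r o p K → (b + (c + (r + r) * b)) + (K * o + p) ≡ b * (2 * r + 1) + K * o + (c + p)
    regroup = solve-∀
    factor : ∀ b K o q → b * K + K * o + q ≡ K * (b + o) + q
    factor = solve-∀

  length-filter-map : ∀ {A : Set} (f : A → ℕ) k xs → length (filter (λ x → f x Nat.≟ k) xs) ≡ occurrences (map f xs) k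
  length-filter-map f k []       = refl
  length-filter-map f k (x ∷ xs) with does (f x Nat.≟ k)
  ... | true  = cong suc (length-filter-map f k xs)
  ... | false = length-filter-map f k xs

  concatMap-cong-∈ : ∀ {A B : Set} {f g : A → List B} xs → (∀ {x} → x ∈ xs → f x ≡ g x) → concatMap f xs ≡ concatMap g xs
  concatMap-cong-∈ []       _    = refl
  concatMap-cong-∈ (x ∷ xs) f≡g = cong₂ _++_ (f≡g (here refl)) (concatMap-cong-∈ xs (f≡g ∘ there))

  SB≡occurrences : ∀ n k → SB n k ≡ occurrences (map repNonZeroBlocks (typeBPartitions n)) k
  SB≡occurrences n k = length-filter-map repNonZeroBlocks k (typeBPartitions n)

  reps-suc↭ : ∀ m → map repNonZeroBlocks (typeBPartitions (suc m)) ↭ concatMap spread (map repNonZeroBlocks (typeBPartitions m))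
  reps-suc↭ m = ↭-trans (Perm.map⁺ repNonZeroBlocks typeBPartitions-suc↭) (↭-reflexive (begin
    map repNonZeroBlocks extensions
      ≡⟨ Listₚ.map-concatMap repNonZeroBlocks _ (typeBPartitions m) ⟩
    concatMap (λ F → map repNonZeroBlocks (map (extendList F) (choices F))) (typeBPartitions m)
      ≡⟨ concatMap-cong-∈ (typeBPartitions m) (λ {F} F∈ → trans (sym (Listₚ.map-∘ (choices F))) (reps-of-extensions F∈)) ⟩
    concatMap (spread ∘ repNonZeroBlocks) (typeBPartitions m)
      ≡⟨ Listₚ.concatMap-map spread repNonZeroBlocks (typeBPartitions m) ⟨
    concatMap spread (map repNonZeroBlocks (typeBPartitions m))
      ∎))
    where open ≡-Reasoning

  SB-suc : ∀ m k → SB (suc m) k ≡ (2 * k + 1) * SB m k + atPred (SB m) k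
  SB-suc m k = begin
    SB (suc m) k
      ≡⟨ SB≡occurrences (suc m) k ⟩
    occurrences (map repNonZeroBlocks (typeBPartitions (suc m))) k
      ≡⟨ occurrences-↭ (reps-suc↭ m) k ⟩
    occurrences (concatMap spread rs) k
      ≡⟨ occurrences-spread rs k ⟩
    (2 * k + 1) * occurrences rs k + atPred (occurrences rs) k
      ≡⟨ cong₂ (λ x y → (2 * k + 1) * x + y) (SB≡occurrences m k) (atPred-cong k) ⟨
    (2 * k + 1) * SB m k + atPred (SB m) k
      ∎
    where
    open ≡-Reasoning
    rs = map repNonZeroBlocks (typeBPartitions m)
    atPred-cong : ∀ k → atPred (SB m) k ≡ atPred (occurrences rs) k
    atPred-cong zero    = refl
    atPred-cong (suc k) = SB≡occurrences m k

  SB-recurrence : TypeBStirlingRecurrence SB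
  SB-recurrence = record { S-0-0 = refl ; S-0-suc = λ _ → refl ; S-suc = SB-suc }

theorem3p2 : ∀ {c ℓ} (R : CommutativeRing c ℓ) →
    let open CommutativeRing R
        open WithRing R
    in (u : Carrier) (L : ℕ → Carrier) →
       (∀ k → applyL L (fallB k) ≈ pow u k) →
       ∀ n → (BellB n u ≈ applyL L (monomial n))
           × (BellB (suc n) u ≈ BellB n u + u * sumTo n (λ j → ι (Data.Nat._^_ 2 (n ∸ j) Data.Nat.* (n C j)) * BellB j u))
theorem3p2 R u L L-fallB n = moments , recurrence
  where
  open CommutativeRing R
  open WithRing R
  open Sums commutativeSemiring using (Σ≤; Σ≤-cong)
  open Moments R
  open TypeBStirling TypeBPartitions.SB-recurrence using (weight)
  open Bell TypeBPartitions.SB-recurrence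
  open import Relation.Binary.Reasoning.Setoid setoid
  BellB≈Bell : ∀ j → BellB j u ≈ Bell j u
  BellB≈Bell j = reflexive (sumTo≡Σ≤ j _)
  moments : BellB n u ≈ applyL L (monomial n)
  moments = begin
    BellB n u                                      ≈⟨ BellB≈Bell n ⟩
    Bell n u                                       ≈⟨ Σ≤-cong n (λ k _ → *-congˡ (sym (L-fallB k))) ⟩
    Σ≤ n (λ k → ι (SB n k) * applyL L (fallB k))   ≈⟨ applyL-monomial n L ⟨
    applyL L (monomial n)                          ∎
  recurrence : BellB (suc n) u ≈ BellB n u + u * sumTo n (λ j → ι (weight n j) * BellB j u)
  recurrence = begin
    BellB (suc n) u                                          ≈⟨ BellB≈Bell (suc n) ⟩
    Bell (suc n) u                                           ≈⟨ Bell-suc n u ⟩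
    Bell n u + u * Σ≤ n (λ j → ι (weight n j) * Bell j u)    ≈⟨ +-cong (BellB≈Bell n) (*-congˡ (trans (reflexive (sumTo≡Σ≤ n _))
                                                                   (Σ≤-cong n (λ j _ → *-congˡ (BellB≈Bell j))))) ⟨
    BellB n u + u * sumTo n (λ j → ι (weight n j) * BellB j u) ∎
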